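{- No 1-random set $A\subseteq\omega$ is introenumerable.
   Context: Sets are identified with elements of $2^{\omega}$. A set is 1-random (Martin-Löf random) if it is not in $\bigcap_m G_m$ for any uniformly $\Sigma^0_1$ sequence of open sets $(G_m)$ with $\mu(G_m)\le 2^{ -m}$. An enumeration operator is a c.e. set $W$, acting by $W(B)=\{x:(\exists y)[\langle x,y\rangle\in W\wedge D_y\subseteq B]\}$, where $(D_y)$ is the canonical listing of finite sets. An infinite set $X$ is introenumerable if for every infinite $Y\subseteq X$ there is an enumeration operator $\Gamma$ with $\Gamma(Y)=X$. -}

module Defs where

open import Data.Nat using (ℕ; zero; suc; _+_; _*_; _^_; _≤_; _<_)
open import Data.Nat.DivMod using (_/_; _%_)
open import Data.Nat.Binary.Base using (ℕᵇ; 2[1+_]; 1+[2_]) renaming (zero to zeroᵇ; fromℕ to toℕᵇ)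
open import Data.Fin using (Fin)
open import Data.Vec using (Vec; []; _∷_; lookup)
open import Data.Bool using (Bool; true; false; _∧_; _∨_; if_then_else_)
open import Data.List using (List; []; _∷_; length; filter; map; foldr)
open import Data.Bool.ListAction using (any)
open import Data.List.Relation.Unary.All using (All)
open import Data.Product using (Σ; ∃; _×_; _,_)
open import Data.Unit using (⊤)
open import Data.Empty using (⊥)
open import Relation.Nullary using (¬_)
open import Relation.Binary.PropositionalEquality using (_≡_)
open import Function.Bundles using (_⇔_)

data Code : ℕ → Set where
  zeroC : ∀ {n} → Code n
  succC : Code 1
  projC : ∀ {n} → Fin n → Code n
  compC : ∀ {n m} → Code m → Vec (Code n) m → Code n
  precC : ∀ {n} → Code n → Code (suc (suc n)) → Code (suc n)
  muC   : ∀ {n} → Code (suc n) → Code n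

mutual
  data _[_]⇓_ : ∀ {n} → Code n → Vec ℕ n → ℕ → Set where
    ev-zero : ∀ {n} {v : Vec ℕ n} → zeroC [ v ]⇓ 0
    ev-succ : ∀ {x} → succC [ x ∷ [] ]⇓ suc x
    ev-proj : ∀ {n} {i : Fin n} {v} → projC i [ v ]⇓ lookup v i
    ev-comp : ∀ {n m} {f : Code m} {gs : Vec (Code n) m} {v us r} →
              gs [ v ]⇓* us → f [ us ]⇓ r → compC f gs [ v ]⇓ r
    ev-prec0 : ∀ {n} {g : Code n} {h} {v r} →
               g [ v ]⇓ r → precC g h [ 0 ∷ v ]⇓ r
    ev-precS : ∀ {n} {g : Code n} {h} {v k a r} →
               precC g h [ k ∷ v ]⇓ a → h [ k ∷ a ∷ v ]⇓ r →
               precC g h [ suc k ∷ v ]⇓ r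
    ev-mu : ∀ {n} {f : Code (suc n)} {v k} →
            f [ k ∷ v ]⇓ 0 →
            (∀ j → j < k → ∃ λ r → f [ j ∷ v ]⇓ suc r) →
            muC f [ v ]⇓ k

  data _[_]⇓*_ : ∀ {n m} → Vec (Code n) m → Vec ℕ n → Vec ℕ m → Set where
    ev-[] : ∀ {n} {v : Vec ℕ n} → [] [ v ]⇓* []
    ev-∷  : ∀ {n m} {g : Code n} {gs : Vec (Code n) m} {v r rs} →
            g [ v ]⇓ r → gs [ v ]⇓* rs → (g ∷ gs) [ v ]⇓* (r ∷ rs)

Halts : ∀ {n} → Code n → Vec ℕ n → Set
Halts e v = ∃ λ r → e [ v ]⇓ r

-- A c.e. set of pairs is given by a binary code e: ⟨x,y⟩ ∈ W_e iff e halts on (x , y).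
_∈W[_] : ℕ → ℕ → Code 2 → Set
(x ∈W[ y ]) e = Halts e (x ∷ y ∷ [])

Set2ω : Set
Set2ω = ℕ → Bool

_∈_ : ℕ → Set2ω → Set
x ∈ A = A x ≡ true

_⊆_ : Set2ω → Set2ω → Set
Y ⊆ X = ∀ i → i ∈ Y → i ∈ X

Infinite : Set2ω → Set
Infinite X = ∀ n → ∃ λ m → n ≤ m × m ∈ X

-- Binary strings, coded by natural numbers (bijective base-2 coding)

BStr : Set
BStr = List Bool

strᵇ : ℕᵇ → BStr
strᵇ zeroᵇ = []
strᵇ 2[1+ b ] = true ∷ strᵇ b
strᵇ 1+[2 b ] = false ∷ strᵇ b

str : ℕ → BStr
str n = strᵇ (toℕᵇ n)

_≺_ : BStr → Set2ω → Set
[] ≺ A = ⊤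
(b ∷ σ) ≺ A = A 0 ≡ b × σ ≺ (λ i → A (suc i))

isPrefix : BStr → BStr → Bool
isPrefix [] τ = true
isPrefix (b ∷ σ) [] = false
isPrefix (true ∷ σ) (true ∷ τ) = isPrefix σ τ
isPrefix (false ∷ σ) (false ∷ τ) = isPrefix σ τ
isPrefix (true ∷ σ) (false ∷ τ) = false
isPrefix (false ∷ σ) (true ∷ τ) = false

allStr : ℕ → List BStr
allStr zero = [] ∷ []
allStr (suc N) = map (true ∷_) (allStr N) Data.List.++ map (false ∷_) (allStr N)

maxLen : List BStr → ℕ
maxLen = foldr (λ σ k → length σ Data.Nat.⊔ k) 0

countCov : ℕ → List BStr → ℕ
countCov N L = length (filter (λ τ → Data.Bool.T? (any (λ σ → isPrefix σ τ) L)) (allStr N))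

-- μ(⋃_{σ ∈ L} [σ]) ≤ 2^{-m}, computed at resolution N = max length in L:
-- μ = countCov N L / 2^N
MeasureLE : List BStr → ℕ → Set
MeasureLE L m = countCov (maxLen L) L * 2 ^ m ≤ 2 ^ maxLen L

-- Martin-Löf tests: a binary code e enumerating pairs (m , s); the open
-- set G_m is ⋃ { [str s] : e halts on (m , s) }.

_∈G[_]_ : Set2ω → Code 2 → ℕ → Set
A ∈G[ e ] m = ∃ λ s → Halts e (m ∷ s ∷ []) × str s ≺ A

-- μ(G_m) ≤ 2^{-m} for every m: every finite union of enumerated cylinders
-- has measure ≤ 2^{-m} (μ of an open set is the sup over finite sub-unions).
IsMLTest : Code 2 → Set
IsMLTest e = ∀ m (L : List ℕ) → All (λ s → Halts e (m ∷ s ∷ [])) L →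
             MeasureLE (map str L) m

MLRandom : Set2ω → Set
MLRandom A = ∀ (e : Code 2) → IsMLTest e → ¬ (∀ m → A ∈G[ e ] m)

-- Canonical finite sets: D_y = { i : the i-th binary digit of y is 1 }

bit : ℕ → ℕ → ℕ
bit y zero = y % 2
bit y (suc i) = bit (y / 2) i

D[_]⊆_ : ℕ → Set2ω → Set
D[ y ]⊆ B = ∀ i → bit y i ≡ 1 → i ∈ B

_∈Γ[_]_ : ℕ → Code 2 → Set2ω → Set
x ∈Γ[ e ] B = ∃ λ y → (x ∈W[ y ]) e × D[ y ]⊆ B

_applied_≡_ : Code 2 → Set2ω → Set2ω → Set
e applied Y ≡ X = ∀ x → (x ∈Γ[ e ] Y) ⇔ (x ∈ X)

Introenumerable : Set2ω → Set
Introenumerable X = Infinite X ×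
  (∀ Y → Infinite Y → Y ⊆ X → ∃ λ (e : Code 2) → e applied Y ≡ X)

{-# OPTIONS --safe #-}
module Submission where

-- Let Y ⊆ A consist of the elements of A that are not eligible, where an odd x
-- is eligible if A has an even element in [2⌊x/4⌋, x). Y is infinite, so if A
-- were introenumerable an enumeration operator Γ would recover A from Y.
-- Eligibility only depends on even positions, so flipping the bit of A at an
-- eligible x does not change Y: the claims "x ∈ A" that Γ makes at eligible x
-- are guesses about bits Γ cannot see, and m of them are all right with
-- probability at most 2^-m. Adding the null event that A has long gaps in its
-- even or odd part gives a Martin-Löf test (G_m) with A ∈ G_m for all m:
-- unless A has gaps beyond every bound, it has infinitely many eligible
-- elements, all enumerated by Γ. The test is a primitive recursive predicate
-- of finite strings, which runs Γ with a step counter and is compiled into a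
-- code of the model.

open import Defs
open import Relation.Nullary using (¬_)

module ZeroOne where

  open import Data.Nat
  open import Data.Nat.Properties
  open import Data.Bool using (Bool; true; false; _∧_; T)
  open import Data.Product using (_×_; _,_)
  open import Data.Sum using (_⊎_; inj₁; inj₂)
  open import Relation.Binary.PropositionalEquality
  open import Relation.Nullary using (¬_; contradiction)

  boolToℕ : Bool → ℕ
  boolToℕ true = 1
  boolToℕ false = 0

  boolToℕ≤1 : ∀ c → boolToℕ c ≤ 1
  boolToℕ≤1 true = ≤-refl
  boolToℕ≤1 false = z≤n

  boolToℕ-pos⁻¹ : ∀ {c} → 1 ≤ boolToℕ c → c ≡ true
  boolToℕ-pos⁻¹ {true} _ = refl

  boolToℕ[1≤ᵇn] : ∀ {n} → n ≤ 1 → boolToℕ (1 ≤ᵇ n) ≡ n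
  boolToℕ[1≤ᵇn] z≤n = refl
  boolToℕ[1≤ᵇn] (s≤s z≤n) = refl

  ∧-true⁻¹ : ∀ {a c} → (a ∧ c) ≡ true → a ≡ true × c ≡ true
  ∧-true⁻¹ {true} {true} _ = refl , refl

  ≤ᵇ-true : ∀ {m n} → m ≤ n → (m ≤ᵇ n) ≡ true
  ≤ᵇ-true {m} {n} m≤n with m ≤ᵇ n | ≤⇒≤ᵇ m≤n
  ... | true | _ = refl

  ≤ᵇ-true⁻¹ : ∀ {m n} → (m ≤ᵇ n) ≡ true → m ≤ n
  ≤ᵇ-true⁻¹ {m} {n} eq = ≤ᵇ⇒≤ m n (subst T (sym eq) _)

  ≤ᵇ-false : ∀ {m n} → ¬ m ≤ n → (m ≤ᵇ n) ≡ false
  ≤ᵇ-false {m} {n} m≰n with m ≤ᵇ n in eq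
  ... | false = refl
  ... | true = contradiction (≤ᵇ-true⁻¹ eq) m≰n

  sg : ℕ → ℕ
  sg zero = 0
  sg (suc _) = 1

  sg≤1 : ∀ n → sg n ≤ 1
  sg≤1 zero = z≤n
  sg≤1 (suc n) = ≤-refl

  sg≤id : ∀ n → sg n ≤ n
  sg≤id zero = z≤n
  sg≤id (suc n) = s≤s z≤n

  sg-mono-≤ : ∀ {m n} → m ≤ n → sg m ≤ sg n
  sg-mono-≤ {zero} _ = z≤n
  sg-mono-≤ {suc m} {suc n} _ = ≤-refl

  sg-pos : ∀ {n} → 1 ≤ n → 1 ≤ sg n
  sg-pos {suc n} _ = ≤-refl

  sg-pos⁻¹ : ∀ {n} → 1 ≤ sg n → 1 ≤ n
  sg-pos⁻¹ {suc n} _ = s≤s z≤n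

  sg≡0⇒n≡0 : ∀ {n} → sg n ≡ 0 → n ≡ 0
  sg≡0⇒n≡0 {zero} _ = refl

  1≤n⇒1∸n≡0 : ∀ {n} → 1 ≤ n → 1 ∸ n ≡ 0
  1≤n⇒1∸n≡0 {suc n} _ = 0∸n≡0 n

  1≤1∸n⇒n≡0 : ∀ {n} → 1 ≤ 1 ∸ n → n ≡ 0
  1≤1∸n⇒n≡0 {zero} _ = refl
  1≤1∸n⇒n≡0 {suc n} le with () ← subst (1 ≤_) (0∸n≡0 n) le

  χ≤ : ℕ → ℕ → ℕ
  χ≤ m n = 1 ∸ (m ∸ n)

  χ≤-pos : ∀ {m n} → m ≤ n → 1 ≤ χ≤ m n
  χ≤-pos m≤n rewrite m≤n⇒m∸n≡0 m≤n = ≤-refl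

  χ≤-pos⁻¹ : ∀ {m n} → 1 ≤ χ≤ m n → m ≤ n
  χ≤-pos⁻¹ pos = m∸n≡0⇒m≤n (1≤1∸n⇒n≡0 pos)

  *-pos : ∀ {m n} → 1 ≤ m → 1 ≤ n → 1 ≤ m * n
  *-pos {suc m} {suc n} _ _ = s≤s z≤n

  *-pos⁻¹ : ∀ {m n} → 1 ≤ m * n → 1 ≤ m × 1 ≤ n
  *-pos⁻¹ {suc m} {suc n} _ = s≤s z≤n , s≤s z≤n
  *-pos⁻¹ {suc m} {zero} le with () ← subst (1 ≤_) (*-zeroʳ m) le

  +-pos⁻¹ : ∀ {m n} → 1 ≤ m + n → 1 ≤ m ⊎ 1 ≤ n
  +-pos⁻¹ {suc m} _ = inj₁ (s≤s z≤n)
  +-pos⁻¹ {zero} le = inj₂ le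

module Sums where

  open import Data.Nat
  open import Data.Nat.Properties
  open import Data.Product using (∃; _×_; _,_)
  open import Data.Sum using (inj₁; inj₂)
  open import Relation.Binary.PropositionalEquality
  open ZeroOne using (+-pos⁻¹)

  natrec : ℕ → ℕ → (ℕ → ℕ → ℕ) → ℕ
  natrec zero z s = z
  natrec (suc k) z s = s k (natrec k z s)

  natrec-cong : ∀ k {z z′} {s s′ : ℕ → ℕ → ℕ} → z ≡ z′ → (∀ i a → s i a ≡ s′ i a) →
                natrec k z s ≡ natrec k z′ s′
  natrec-cong zero z≡z′ _ = z≡z′
  natrec-cong (suc k) {s = s} z≡z′ s≗s′ = trans (cong (s k) (natrec-cong k z≡z′ s≗s′)) (s≗s′ k _)

  bsum : ℕ → (ℕ → ℕ) → ℕ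
  bsum zero f = 0
  bsum (suc k) f = bsum k f + f k

  bsum-cong< : ∀ k {f g : ℕ → ℕ} → (∀ i → i < k → f i ≡ g i) → bsum k f ≡ bsum k g
  bsum-cong< zero _ = refl
  bsum-cong< (suc k) f≗g = cong₂ _+_ (bsum-cong< k (λ i i<k → f≗g i (m≤n⇒m≤1+n i<k))) (f≗g k ≤-refl)

  bsum-cong : ∀ k {f g : ℕ → ℕ} → (∀ i → f i ≡ g i) → bsum k f ≡ bsum k g
  bsum-cong k f≗g = bsum-cong< k (λ i _ → f≗g i)

  term≤bsum : ∀ k {f : ℕ → ℕ} i → i < k → f i ≤ bsum k f
  term≤bsum (suc k) {f} i i<1+k with m≤n⇒m<n∨m≡n (≤-pred i<1+k)
  ... | inj₁ i<k = ≤-trans (term≤bsum k i i<k) (m≤m+n (bsum k f) (f k))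
  ... | inj₂ refl = m≤n+m (f i) (bsum k f)

  bsum-pos⁻¹ : ∀ k {f : ℕ → ℕ} → 1 ≤ bsum k f → ∃ λ i → i < k × 1 ≤ f i
  bsum-pos⁻¹ (suc k) {f} pos with +-pos⁻¹ {bsum k f} pos
  ... | inj₂ fk-pos = k , ≤-refl , fk-pos
  ... | inj₁ sum-pos with bsum-pos⁻¹ k sum-pos
  ...   | i , i<k , fi-pos = i , m≤n⇒m≤1+n i<k , fi-pos

  bsum≡0⇒term≡0 : ∀ k {f : ℕ → ℕ} → bsum k f ≡ 0 → ∀ i → i < k → f i ≡ 0
  bsum≡0⇒term≡0 (suc k) {f} eq i i<1+k with m≤n⇒m<n∨m≡n (≤-pred i<1+k)
  ... | inj₁ i<k = bsum≡0⇒term≡0 k (m+n≡0⇒m≡0 (bsum k f) eq) i i<k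
  ... | inj₂ refl = m+n≡0⇒n≡0 (bsum k f) eq

  terms≡0⇒bsum≡0 : ∀ k {f : ℕ → ℕ} → (∀ i → i < k → f i ≡ 0) → bsum k f ≡ 0
  terms≡0⇒bsum≡0 zero _ = refl
  terms≡0⇒bsum≡0 (suc k) f≡0 =
    cong₂ _+_ (terms≡0⇒bsum≡0 k (λ i i<k → f≡0 i (m≤n⇒m≤1+n i<k))) (f≡0 k ≤-refl)

  bsum-monoˡ-≤ : ∀ {k k′} (f : ℕ → ℕ) → k ≤ k′ → bsum k f ≤ bsum k′ f
  bsum-monoˡ-≤ {k} {k′} f k≤k′ with m≤n⇒m<n∨m≡n k≤k′
  ... | inj₂ refl = ≤-refl
  ... | inj₁ (s≤s {n = k″} k≤k″) = ≤-trans (bsum-monoˡ-≤ f k≤k″) (m≤m+n (bsum k″ f) (f k″))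

  bsum-monoʳ-≤ : ∀ k {f g : ℕ → ℕ} → (∀ i → i < k → f i ≤ g i) → bsum k f ≤ bsum k g
  bsum-monoʳ-≤ zero _ = z≤n
  bsum-monoʳ-≤ (suc k) f≤g = +-mono-≤ (bsum-monoʳ-≤ k (λ i i<k → f≤g i (m≤n⇒m≤1+n i<k))) (f≤g k ≤-refl)

  bsum-+ : ∀ k d (f : ℕ → ℕ) → bsum (k + d) f ≡ bsum k f + bsum d (λ i → f (k + i))
  bsum-+ k zero f rewrite +-identityʳ k = sym (+-identityʳ _)
  bsum-+ k (suc d) f rewrite +-suc k d | bsum-+ k d f = +-assoc (bsum k f) _ _

  bsum-const-1 : ∀ k → bsum k (λ _ → 1) ≡ k
  bsum-const-1 zero = refl
  bsum-const-1 (suc k) = trans (cong (_+ 1) (bsum-const-1 k)) (+-comm k 1)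

  bsum-pairs : ∀ k (f : ℕ → ℕ) → bsum (2 * k) f ≡ bsum k (λ q → f (2 * q) + f (suc (2 * q)))
  bsum-pairs zero f = refl
  bsum-pairs (suc k) f = begin
    bsum (2 * suc k) f                                        ≡⟨ cong (λ n → bsum n f) (*-suc 2 k) ⟩
    bsum (2 * k) f + f (2 * k) + f (suc (2 * k))              ≡⟨ +-assoc (bsum (2 * k) f) _ _ ⟩
    bsum (2 * k) f + (f (2 * k) + f (suc (2 * k)))            ≡⟨ cong (_+ (f (2 * k) + f (suc (2 * k)))) (bsum-pairs k f) ⟩
    bsum k (λ q → f (2 * q) + f (suc (2 * q))) + (f (2 * k) + f (suc (2 * k))) ∎
    where open ≡-Reasoning

module PrimRec where

  open import Data.Nat
  open import Data.Nat.Properties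
  open import Data.Nat.DivMod
  open import Data.Fin using (Fin; zero; suc; _↑ʳ_)
  open import Data.Vec using (Vec; []; _∷_; _++_; lookup; tabulate)
  open import Data.Vec.Properties using (tabulate∘lookup; tabulate-cong; lookup-++ʳ)
  open import Data.Product using (proj₂)
  open import Data.Empty using (⊥-elim)
  open import Function using (_∘_)
  open import Relation.Binary.PropositionalEquality
  open import Relation.Binary.Definitions using (tri<; tri≈; tri>)
  open ZeroOne using (sg)
  open Sums using (natrec)

  mutual
    ⇓-deterministic : ∀ {n} {e : Code n} {v r r′} → e [ v ]⇓ r → e [ v ]⇓ r′ → r ≡ r′
    ⇓-deterministic ev-zero ev-zero = refl
    ⇓-deterministic ev-succ ev-succ = refl
    ⇓-deterministic ev-proj ev-proj = refl
    ⇓-deterministic (ev-comp gs f) (ev-comp gs′ f′) with ⇓*-deterministic gs gs′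
    ... | refl = ⇓-deterministic f f′
    ⇓-deterministic (ev-prec0 g) (ev-prec0 g′) = ⇓-deterministic g g′
    ⇓-deterministic (ev-precS p h) (ev-precS p′ h′) with ⇓-deterministic p p′
    ... | refl = ⇓-deterministic h h′
    ⇓-deterministic (ev-mu {k = k} f0 below) (ev-mu {k = k′} f0′ below′) with <-cmp k k′
    ... | tri< k<k′ _ _ = ⊥-elim (0≢1+n (⇓-deterministic f0 (proj₂ (below′ k k<k′))))
    ... | tri≈ _ k≡k′ _ = k≡k′
    ... | tri> _ _ k′<k = ⊥-elim (0≢1+n (⇓-deterministic f0′ (proj₂ (below k′ k′<k))))

    ⇓*-deterministic : ∀ {n m} {gs : Vec (Code n) m} {v rs rs′} →
                       gs [ v ]⇓* rs → gs [ v ]⇓* rs′ → rs ≡ rs′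
    ⇓*-deterministic ev-[] ev-[] = refl
    ⇓*-deterministic (ev-∷ g gs) (ev-∷ g′ gs′) = cong₂ _∷_ (⇓-deterministic g g′) (⇓*-deterministic gs gs′)

  record PR (n : ℕ) : Set where
    constructor mkPR
    field
      code     : Code n
      fn       : Vec ℕ n → ℕ
      computes : ∀ v → code [ v ]⇓ fn v
  open PR public

  fns : ∀ {n k} → Vec (PR n) k → Vec ℕ n → Vec ℕ k
  fns [] v = []
  fns (p ∷ ps) v = fn p v ∷ fns ps v

  codes : ∀ {n k} → Vec (PR n) k → Vec (Code n) k
  codes [] = []
  codes (p ∷ ps) = code p ∷ codes ps

  codes-compute : ∀ {n k} (ps : Vec (PR n) k) v → codes ps [ v ]⇓* fns ps v
  codes-compute [] v = ev-[]
  codes-compute (p ∷ ps) v = ev-∷ (computes p v) (codes-compute ps v)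

  compPR : ∀ {n k} → PR k → Vec (PR n) k → PR n
  compPR p ps = mkPR (compC (code p) (codes ps)) (λ v → fn p (fns ps v))
                     (λ v → ev-comp (codes-compute ps v) (computes p _))

  primRec : ∀ {n} → (Vec ℕ n → ℕ) → (Vec ℕ (2 + n) → ℕ) → Vec ℕ (suc n) → ℕ
  primRec g h (k ∷ v) = natrec k (g v) (λ i a → h (i ∷ a ∷ v))

  precPR : ∀ {n} → PR n → PR (2 + n) → PR (suc n)
  precPR g h = mkPR (precC (code g) (code h)) (primRec (fn g) (fn h)) prec-computes
    where
    prec-computes : ∀ v → precC (code g) (code h) [ v ]⇓ primRec (fn g) (fn h) v
    prec-computes (zero ∷ v) = ev-prec0 (computes g v)
    prec-computes (suc k ∷ v) = ev-precS (prec-computes (k ∷ v)) (computes h _)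

  withFn : ∀ {n} (p : PR n) (f : Vec ℕ n → ℕ) → (∀ v → fn p v ≡ f v) → PR n
  withFn p f fn≗f = mkPR (code p) f (λ v → subst (code p [ v ]⇓_) (fn≗f v) (computes p v))

  projPR : ∀ {n} → Fin n → PR n
  projPR i = mkPR (projC i) (λ v → lookup v i) (λ v → ev-proj)

  zeroPR : ∀ {n} → PR n
  zeroPR = mkPR zeroC (λ _ → 0) (λ _ → ev-zero)

  succPR : PR 1
  succPR = mkPR succC succ succ-computes
    where
    succ : Vec ℕ 1 → ℕ
    succ (x ∷ []) = suc x
    succ-computes : ∀ v → succC [ v ]⇓ succ v
    succ-computes (x ∷ []) = ev-succ

  constPR : ∀ {n} → ℕ → PR n
  constPR c = withFn (iterate-succ c) (λ _ → c) (iterate-succ-fn c)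
    where
    iterate-succ : ∀ {n} → ℕ → PR n
    iterate-succ zero = zeroPR
    iterate-succ (suc c) = compPR succPR (iterate-succ c ∷ [])
    iterate-succ-fn : ∀ {n} c (v : Vec ℕ n) → fn (iterate-succ c) v ≡ c
    iterate-succ-fn zero v = refl
    iterate-succ-fn (suc c) v = cong suc (iterate-succ-fn c v)

  projs : ∀ {n k} → (Fin k → Fin n) → Vec (PR n) k
  projs {k = zero} ρ = []
  projs {k = suc k} ρ = projPR (ρ zero) ∷ projs (ρ ∘ suc)

  projs-fns : ∀ {n k} (ρ : Fin k → Fin n) v → fns (projs ρ) v ≡ tabulate (lookup v ∘ ρ)
  projs-fns {k = zero} ρ v = refl
  projs-fns {k = suc k} ρ v = cong (lookup v (ρ zero) ∷_) (projs-fns (ρ ∘ suc) v)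

  allVars : ∀ {n} → Vec (PR n) n
  allVars = projs (λ i → i)

  allVars-fns : ∀ {n} (v : Vec ℕ n) → fns allVars v ≡ v
  allVars-fns v = trans (projs-fns (λ i → i) v) (tabulate∘lookup v)

  dropVars : ∀ k {n} → Vec (PR (k + n)) n
  dropVars k = projs (k ↑ʳ_)

  dropVars-fns : ∀ {k n} (u : Vec ℕ k) (v : Vec ℕ n) → fns (dropVars k) (u ++ v) ≡ v
  dropVars-fns u v = trans (projs-fns (_ ↑ʳ_) (u ++ v))
                           (trans (tabulate-cong (lookup-++ʳ u v)) (tabulate∘lookup v))

  private
    binary : (ℕ → ℕ → ℕ) → Vec ℕ 2 → ℕ
    binary _⊕_ (a ∷ b ∷ []) = a ⊕ b

    unary : (ℕ → ℕ) → Vec ℕ 1 → ℕ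
    unary f (a ∷ []) = f a

  addPR : PR 2
  addPR = withFn add (binary _+_) add-fn
    where
    add : PR 2
    add = precPR (projPR zero) (compPR succPR (projPR (suc zero) ∷ []))
    add-fn : ∀ v → fn add v ≡ binary _+_ v
    add-fn (zero ∷ b ∷ []) = refl
    add-fn (suc a ∷ b ∷ []) = cong suc (add-fn (a ∷ b ∷ []))

  mulPR : PR 2
  mulPR = withFn mul (binary _*_) mul-fn
    where
    mul : PR 2
    mul = precPR zeroPR (compPR addPR (projPR (suc (suc zero)) ∷ projPR (suc zero) ∷ []))
    mul-fn : ∀ v → fn mul v ≡ binary _*_ v
    mul-fn (zero ∷ b ∷ []) = refl
    mul-fn (suc a ∷ b ∷ []) = cong (b +_) (mul-fn (a ∷ b ∷ []))

  predPR : PR 1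
  predPR = withFn pred′ (unary pred) pred-fn
    where
    pred′ : PR 1
    pred′ = precPR zeroPR (projPR zero)
    pred-fn : ∀ v → fn pred′ v ≡ unary pred v
    pred-fn (zero ∷ []) = refl
    pred-fn (suc a ∷ []) = refl

  monusPR : PR 2
  monusPR = withFn (compPR flipped (projPR (suc zero) ∷ projPR zero ∷ [])) (binary _∸_) monus-fn
    where
    flipped : PR 2
    flipped = precPR (projPR zero) (compPR predPR (projPR (suc zero) ∷ []))
    flipped-fn : ∀ a b → fn flipped (b ∷ a ∷ []) ≡ a ∸ b
    flipped-fn a zero = refl
    flipped-fn a (suc b) = trans (cong pred (flipped-fn a b)) (pred[m∸n]≡m∸[1+n] a b)
    monus-fn : ∀ v → fn (compPR flipped (projPR (suc zero) ∷ projPR zero ∷ [])) v ≡ binary _∸_ v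
    monus-fn (a ∷ b ∷ []) = flipped-fn a b

  sgPR : PR 1
  sgPR = withFn sg′ (unary sg) sg-fn
    where
    sg′ : PR 1
    sg′ = precPR zeroPR (constPR 1)
    sg-fn : ∀ v → fn sg′ v ≡ unary sg v
    sg-fn (zero ∷ []) = refl
    sg-fn (suc a ∷ []) = refl

  parityPR : PR 1
  parityPR = withFn parity′ (unary (_% 2)) parity-fn
    where
    parity′ : PR 1
    parity′ = precPR zeroPR (compPR monusPR (constPR 1 ∷ projPR (suc zero) ∷ []))
    %2-suc : ∀ a → suc a % 2 ≡ 1 ∸ a % 2
    %2-suc zero = refl
    %2-suc (suc zero) = refl
    %2-suc (suc (suc a)) = %2-suc a
    parity-fn : ∀ v → fn parity′ v ≡ unary (_% 2) v
    parity-fn (zero ∷ []) = refl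
    parity-fn (suc a ∷ []) = trans (cong (1 ∸_) (parity-fn (a ∷ []))) (sym (%2-suc a))

  halfPR : PR 1
  halfPR = withFn half (unary (_/ 2)) half-fn
    where
    half : PR 1
    half = precPR zeroPR (compPR addPR (projPR (suc zero) ∷ compPR parityPR (projPR zero ∷ []) ∷ []))
    /2-suc : ∀ a → suc a / 2 ≡ a / 2 + a % 2
    /2-suc zero = refl
    /2-suc (suc zero) = refl
    /2-suc (suc (suc a)) = begin
      (3 + a) / 2         ≡⟨ m/n≡1+[m∸n]/n {3 + a} {2} (s≤s (s≤s z≤n)) ⟩
      1 + (1 + a) / 2     ≡⟨ cong suc (/2-suc a) ⟩
      1 + a / 2 + a % 2   ≡⟨ cong (_+ a % 2) (m/n≡1+[m∸n]/n {2 + a} {2} (s≤s (s≤s z≤n))) ⟨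
      (2 + a) / 2 + a % 2 ∎
      where open ≡-Reasoning
    half-fn : ∀ v → fn half v ≡ unary (_/ 2) v
    half-fn (zero ∷ []) = refl
    half-fn (suc a ∷ []) = trans (cong (_+ a % 2) (half-fn (a ∷ []))) (sym (/2-suc a))

module OracleExpr where

  open import Data.Nat
  open import Data.Fin using (Fin; zero; suc)
  open import Data.Fin using (_↑ʳ_)
  open import Data.Vec using (Vec; []; _∷_; _++_; lookup; tabulate)
  open import Data.Vec.Properties using (tabulate∘lookup; tabulate-cong; lookup-++ʳ)
  open import Function using (_∘_)
  open import Relation.Binary.PropositionalEquality
  open Sums using (natrec; natrec-cong; bsum; bsum-cong)
  open PrimRec

  -- Arithmetic terms over an oracle b : ℕ → ℕ and a bound N; in use, b and N are
  -- the bits and the length of a finite string.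
  data Expr : ℕ → Set where
    var       : ∀ {n} → Fin n → Expr n
    prim      : ∀ {n k} → PR k → Vec (Expr n) k → Expr n
    sub       : ∀ {n k} → Expr k → Vec (Expr n) k → Expr n
    sum       : ∀ {n} → Expr n → Expr (suc n) → Expr n
    rec       : ∀ {n} → Expr n → Expr n → Expr (2 + n) → Expr n
    oracle    : ∀ {n} → Expr n → Expr n
    oracleLen : ∀ {n} → Expr n

  lit : ∀ {n} → ℕ → Expr n
  lit c = prim (constPR c) []

  infixl 6 _+ᴱ_ _∸ᴱ_
  infixl 7 _*ᴱ_

  _+ᴱ_ _*ᴱ_ _∸ᴱ_ : ∀ {n} → Expr n → Expr n → Expr n
  a +ᴱ c = prim addPR (a ∷ c ∷ [])
  a *ᴱ c = prim mulPR (a ∷ c ∷ [])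
  a ∸ᴱ c = prim monusPR (a ∷ c ∷ [])

  sucᴱ predᴱ sgᴱ halfᴱ parityᴱ : ∀ {n} → Expr n → Expr n
  sucᴱ a = prim succPR (a ∷ [])
  predᴱ a = prim predPR (a ∷ [])
  sgᴱ a = prim sgPR (a ∷ [])
  halfᴱ a = prim halfPR (a ∷ [])
  parityᴱ a = prim parityPR (a ∷ [])

  vars : ∀ {n k} → (Fin k → Fin n) → Vec (Expr n) k
  vars {k = zero} ρ = []
  vars {k = suc k} ρ = var (ρ zero) ∷ vars (ρ ∘ suc)

  dropVarsᴱ : ∀ k {n} → Vec (Expr (k + n)) n
  dropVarsᴱ k = vars (k ↑ʳ_)

  module Sem (b : ℕ → ℕ) (N : ℕ) where
    mutual
      ⟦_⟧ : ∀ {n} → Expr n → Vec ℕ n → ℕ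
      ⟦ var i ⟧ v = lookup v i
      ⟦ prim p es ⟧ v = fn p (⟦ es ⟧* v)
      ⟦ sub e es ⟧ v = ⟦ e ⟧ (⟦ es ⟧* v)
      ⟦ sum k f ⟧ v = bsum (⟦ k ⟧ v) (λ i → ⟦ f ⟧ (i ∷ v))
      ⟦ rec k z s ⟧ v = natrec (⟦ k ⟧ v) (⟦ z ⟧ v) (λ i a → ⟦ s ⟧ (i ∷ a ∷ v))
      ⟦ oracle e ⟧ v = b (⟦ e ⟧ v)
      ⟦ oracleLen ⟧ v = N

      ⟦_⟧* : ∀ {n k} → Vec (Expr n) k → Vec ℕ n → Vec ℕ k
      ⟦ [] ⟧* v = []
      ⟦ e ∷ es ⟧* v = ⟦ e ⟧ v ∷ ⟦ es ⟧* v

    ⟦vars⟧ : ∀ {n k} (ρ : Fin k → Fin n) v → ⟦ vars ρ ⟧* v ≡ tabulate (lookup v ∘ ρ)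
    ⟦vars⟧ {k = zero} ρ v = refl
    ⟦vars⟧ {k = suc k} ρ v = cong (lookup v (ρ zero) ∷_) (⟦vars⟧ (ρ ∘ suc) v)

    ⟦dropVarsᴱ⟧ : ∀ {k n} (u : Vec ℕ k) (v : Vec ℕ n) → ⟦ dropVarsᴱ k ⟧* (u ++ v) ≡ v
    ⟦dropVarsᴱ⟧ u v = trans (⟦vars⟧ (_ ↑ʳ_) (u ++ v)) (trans (tabulate-cong (lookup-++ʳ u v)) (tabulate∘lookup v))

  module SemCong (b b′ : ℕ → ℕ) (N N′ : ℕ) (b≗b′ : ∀ i → b i ≡ b′ i) (N≡N′ : N ≡ N′) where
    open Sem b N
    open Sem b′ N′ renaming (⟦_⟧ to ⟦_⟧′; ⟦_⟧* to ⟦_⟧*′)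

    mutual
      ⟦⟧-cong : ∀ {n} (e : Expr n) v → ⟦ e ⟧ v ≡ ⟦ e ⟧′ v
      ⟦⟧-cong (var i) v = refl
      ⟦⟧-cong (prim p es) v = cong (fn p) (⟦⟧*-cong es v)
      ⟦⟧-cong (sub e es) v = trans (cong ⟦ e ⟧ (⟦⟧*-cong es v)) (⟦⟧-cong e _)
      ⟦⟧-cong (sum k f) v =
        trans (cong (λ K → bsum K (λ i → ⟦ f ⟧ (i ∷ v))) (⟦⟧-cong k v))
              (bsum-cong (⟦ k ⟧′ v) (λ i → ⟦⟧-cong f (i ∷ v)))
      ⟦⟧-cong (rec k z s) v =
        trans (cong (λ K → natrec K (⟦ z ⟧ v) (λ i a → ⟦ s ⟧ (i ∷ a ∷ v))) (⟦⟧-cong k v))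
              (natrec-cong (⟦ k ⟧′ v) (⟦⟧-cong z v) (λ i a → ⟦⟧-cong s (i ∷ a ∷ v)))
      ⟦⟧-cong (oracle e) v = trans (cong b (⟦⟧-cong e v)) (b≗b′ _)
      ⟦⟧-cong oracleLen v = N≡N′

      ⟦⟧*-cong : ∀ {n k} (es : Vec (Expr n) k) v → ⟦ es ⟧* v ≡ ⟦ es ⟧*′ v
      ⟦⟧*-cong [] v = refl
      ⟦⟧*-cong (e ∷ es) v = cong₂ _∷_ (⟦⟧-cong e v) (⟦⟧*-cong es v)

  sumPR : ∀ {n} → PR (suc n) → PR (suc n)
  sumPR {n} f = withFn summation bounded-sum summation-fn
    where
    summation : PR (suc n)
    summation = precPR zeroPR (compPR addPR (projPR (suc zero) ∷ compPR f (projPR zero ∷ dropVars 2) ∷ []))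
    bounded-sum : Vec ℕ (suc n) → ℕ
    bounded-sum (k ∷ v) = bsum k (λ i → fn f (i ∷ v))
    summation-fn : ∀ v → fn summation v ≡ bounded-sum v
    summation-fn (zero ∷ v) = refl
    summation-fn (suc k ∷ v) =
      cong₂ _+_ (summation-fn (k ∷ v)) (cong (λ w → fn f (k ∷ w)) (dropVars-fns (k ∷ _ ∷ []) v))

  -- Compilation of a term into a code with one extra leading argument s; the
  -- oracle is then i ↦ B(i, s) and the bound L(s).
  module Compile (B : PR 2) (L : PR 1) where
    mutual
      compile : ∀ {n} → Expr n → PR (suc n)
      compile (var i) = projPR (suc i)
      compile (prim p es) = compPR p (compile* es)
      compile (sub e es) = compPR (compile e) (projPR zero ∷ compile* es)
      compile (sum k f) =
        compPR (sumPR (compPR (compile f) (projPR (suc zero) ∷ projPR zero ∷ dropVars 2)))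
               (compile k ∷ allVars)
      compile (rec k z s) =
        compPR (precPR (compile z)
                       (compPR (compile s) (projPR (suc (suc zero)) ∷ projPR zero ∷ projPR (suc zero) ∷ dropVars 3)))
               (compile k ∷ allVars)
      compile (oracle e) = compPR B (compile e ∷ projPR zero ∷ [])
      compile oracleLen = compPR L (projPR zero ∷ [])

      compile* : ∀ {n k} → Vec (Expr n) k → Vec (PR (suc n)) k
      compile* [] = []
      compile* (e ∷ es) = compile e ∷ compile* es

    query : ℕ → ℕ → ℕ
    query s i = fn B (i ∷ s ∷ [])

    bound : ℕ → ℕ
    bound s = fn L (s ∷ [])

    mutual
      compile-correct : ∀ {n} (e : Expr n) s v → fn (compile e) (s ∷ v) ≡ Sem.⟦_⟧ (query s) (bound s) e v
      compile-correct (var i) s v = refl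
      compile-correct (prim p es) s v = cong (fn p) (compile*-correct es s v)
      compile-correct (sub e es) s v =
        trans (cong (λ w → fn (compile e) (s ∷ w)) (compile*-correct es s v)) (compile-correct e s _)
      compile-correct (sum k f) s v rewrite allVars-fns (s ∷ v) | compile-correct k s v =
        bsum-cong (Sem.⟦_⟧ (query s) (bound s) k v) (λ i → trans (cong (λ w → fn (compile f) (s ∷ i ∷ w)) (dropVars-fns (i ∷ s ∷ []) v))
                                 (compile-correct f s (i ∷ v)))
      compile-correct (rec k z st) s v rewrite allVars-fns (s ∷ v) | compile-correct k s v =
        natrec-cong (Sem.⟦_⟧ (query s) (bound s) k v) (compile-correct z s v)
          (λ i a → trans (cong (λ w → fn (compile st) (s ∷ i ∷ a ∷ w)) (dropVars-fns (i ∷ a ∷ s ∷ []) v))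
                         (compile-correct st s (i ∷ a ∷ v)))
      compile-correct (oracle e) s v = cong (λ x → fn B (x ∷ s ∷ [])) (compile-correct e s v)
      compile-correct oracleLen s v = refl

      compile*-correct : ∀ {n k} (es : Vec (Expr n) k) s v →
                         fns (compile* es) (s ∷ v) ≡ Sem.⟦_⟧* (query s) (bound s) es v
      compile*-correct [] s v = refl
      compile*-correct (e ∷ es) s v = cong₂ _∷_ (compile-correct e s v) (compile*-correct es s v)

  module Closed = Sem (λ _ → 0) 0

  exprPR : ∀ {n} → Expr n → PR n
  exprPR {n} e = withFn closed Closed.⟦ e ⟧ closed-fn
    where
    open Compile zeroPR zeroPR
    closed : PR n
    closed = compPR (compile e) (zeroPR ∷ allVars)
    closed-fn : ∀ v → fn closed v ≡ Closed.⟦ e ⟧ v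
    closed-fn v = trans (cong (λ w → fn (compile e) (0 ∷ w)) (allVars-fns v)) (compile-correct e 0 v)

module Timed where

  open import Data.Nat
  open import Data.Nat.Properties
  open import Data.Fin using (zero; suc)
  open import Data.Vec using (Vec; []; _∷_; lookup; map)
  open import Data.Product using (∃; _×_; _,_; proj₁; proj₂)
  open import Data.Sum using (_⊎_; inj₁; inj₂)
  open import Relation.Binary.PropositionalEquality
  open ZeroOne using (sg)
  open Sums using (natrec; natrec-cong)
  open PrimRec
  open OracleExpr
  open Closed using (⟦_⟧; ⟦_⟧*; ⟦dropVarsᴱ⟧)

  -- State of a bounded μ-search: 0 while all trials so far returned a nonzero
  -- value, 1 once a trial did not halt within the budget, 2 + k once k was found.
  searchStep : ℕ → ℕ → ℕ → ℕ
  searchStep zero zero j = 1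
  searchStep zero (suc zero) j = suc (suc j)
  searchStep zero (suc (suc _)) j = 0
  searchStep (suc s) c j = suc s

  searchStepPR : PR 3
  searchStepPR = withFn (exprPR stepᴱ) step step-fn
    where
    stepᴱ : Expr 3
    stepᴱ = var zero +ᴱ (lit 1 ∸ᴱ var zero)
                        *ᴱ ((lit 1 ∸ᴱ var (suc zero))
                           +ᴱ (lit 1 ∸ᴱ (var (suc zero) ∸ᴱ lit 1)) *ᴱ sgᴱ (var (suc zero)) *ᴱ sucᴱ (sucᴱ (var (suc (suc zero)))))
    step : Vec ℕ 3 → ℕ
    step (s ∷ c ∷ j ∷ []) = searchStep s c j
    step-fn : ∀ v → ⟦ stepᴱ ⟧ v ≡ step v
    step-fn (zero ∷ zero ∷ j ∷ []) = refl
    step-fn (zero ∷ suc zero ∷ j ∷ []) rewrite +-identityʳ j | +-identityʳ j = refl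
    step-fn (zero ∷ suc (suc c) ∷ j ∷ []) rewrite 0∸n≡0 c = refl
    step-fn (suc s ∷ c ∷ j ∷ []) rewrite 0∸n≡0 s = +-identityʳ (suc s)

  allPos : ∀ {m} → Vec ℕ m → ℕ
  allPos [] = 1
  allPos (c ∷ cs) = sg c * allPos cs

  allPosᴱ : ∀ {n m} → Vec (Expr n) m → Expr n
  allPosᴱ [] = lit 1
  allPosᴱ (c ∷ cs) = sgᴱ c *ᴱ allPosᴱ cs

  -- timed t e v is 0 if e has not halted on v within budget t and 1 + r if it
  -- halted with value r; the budget t bounds the length of every μ-search.
  mutual
    timedᴱ : ∀ {n} → Code n → Expr (suc n)
    timedᴱ zeroC = lit 1
    timedᴱ succC = sucᴱ (sucᴱ (var (suc zero)))
    timedᴱ (projC i) = sucᴱ (var (suc i))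
    timedᴱ (compC f gs) = allPosᴱ (timedᴱ* gs) *ᴱ sub (timedᴱ f) (var zero ∷ map predᴱ (timedᴱ* gs))
    timedᴱ (precC g h) =
      rec (var (suc zero)) (sub (timedᴱ g) (var zero ∷ dropVarsᴱ 2))
          (sgᴱ (var (suc zero)) *ᴱ sub (timedᴱ h) (var (suc (suc zero)) ∷ var zero ∷ predᴱ (var (suc zero)) ∷ dropVarsᴱ 4))
    timedᴱ (muC f) =
      predᴱ (rec (var zero) (lit 0)
                 (prim searchStepPR (var (suc zero) ∷ sub (timedᴱ f) (var (suc (suc zero)) ∷ var zero ∷ dropVarsᴱ 3) ∷ var zero ∷ [])))

    timedᴱ* : ∀ {n m} → Vec (Code n) m → Vec (Expr (suc n)) m
    timedᴱ* [] = []
    timedᴱ* (g ∷ gs) = timedᴱ g ∷ timedᴱ* gs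

  timed : ∀ {n} → ℕ → Code n → Vec ℕ n → ℕ
  timed t e v = ⟦ timedᴱ e ⟧ (t ∷ v)

  timed* : ∀ {n m} → ℕ → Vec (Code n) m → Vec ℕ n → Vec ℕ m
  timed* t gs v = ⟦ timedᴱ* gs ⟧* (t ∷ v)

  timedPR : ∀ {n} → Code n → PR (suc n)
  timedPR e = exprPR (timedᴱ e)

  timed-comp : ∀ {n m} t (f : Code m) (gs : Vec (Code n) m) v →
    timed t (compC f gs) v ≡ allPos (timed* t gs v) * timed t f (map pred (timed* t gs v))
  timed-comp t f gs v = cong₂ _*_ (⟦allPos⟧ (timedᴱ* gs)) (cong (λ w → ⟦ timedᴱ f ⟧ (t ∷ w)) (⟦map-pred⟧ (timedᴱ* gs)))
    where
    ⟦allPos⟧ : ∀ {m} (cs : Vec (Expr _) m) → ⟦ allPosᴱ cs ⟧ (t ∷ v) ≡ allPos (⟦ cs ⟧* (t ∷ v))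
    ⟦allPos⟧ [] = refl
    ⟦allPos⟧ (c ∷ cs) = cong (sg (⟦ c ⟧ (t ∷ v)) *_) (⟦allPos⟧ cs)
    ⟦map-pred⟧ : ∀ {m} (cs : Vec (Expr _) m) → ⟦ map predᴱ cs ⟧* (t ∷ v) ≡ map pred (⟦ cs ⟧* (t ∷ v))
    ⟦map-pred⟧ [] = refl
    ⟦map-pred⟧ (c ∷ cs) = cong (pred (⟦ c ⟧ (t ∷ v)) ∷_) (⟦map-pred⟧ cs)

  precStep : ∀ {n} → ℕ → Code (2 + n) → Vec ℕ n → ℕ → ℕ → ℕ
  precStep t h v i a = sg a * timed t h (i ∷ pred a ∷ v)

  timed-prec : ∀ {n} t (g : Code n) h k v →
    timed t (precC g h) (k ∷ v) ≡ natrec k (timed t g v) (precStep t h v)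
  timed-prec t g h k v =
    natrec-cong k (cong (λ w → ⟦ timedᴱ g ⟧ (t ∷ w)) (⟦dropVarsᴱ⟧ (t ∷ k ∷ []) v))
      (λ i a → cong (λ w → sg a * ⟦ timedᴱ h ⟧ (t ∷ i ∷ pred a ∷ w)) (⟦dropVarsᴱ⟧ (i ∷ a ∷ t ∷ k ∷ []) v))

  muStep : ∀ {n} → ℕ → Code (suc n) → Vec ℕ n → ℕ → ℕ → ℕ
  muStep t f v j s = searchStep s (timed t f (j ∷ v)) j

  timed-mu : ∀ {n} t (f : Code (suc n)) v → timed t (muC f) v ≡ pred (natrec t 0 (muStep t f v))
  timed-mu t f v =
    cong pred (natrec-cong t refl (λ j s → cong (λ w → searchStep s (⟦ timedᴱ f ⟧ (t ∷ j ∷ w)) j)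
                                                (⟦dropVarsᴱ⟧ (j ∷ s ∷ t ∷ []) v)))

  module Search (c : ℕ → ℕ) where

    NonzeroBelow : ℕ → Set
    NonzeroBelow k = ∀ i → i < k → ∃ λ r → c i ≡ suc (suc r)

    state : ℕ → ℕ
    state j = natrec j 0 (λ j s → searchStep s (c j) j)

    searching⇒nonzero : ∀ j → state j ≡ 0 → NonzeroBelow j
    searching⇒nonzero (suc j) eq i i<1+j with state j in eqj
    searching⇒nonzero (suc j) eq i i<1+j | zero with c j in eqc
    searching⇒nonzero (suc j) () i i<1+j | zero | zero
    searching⇒nonzero (suc j) () i i<1+j | zero | suc zero
    searching⇒nonzero (suc j) eq i i<1+j | zero | suc (suc r) with m≤n⇒m<n∨m≡n (≤-pred i<1+j)
    ... | inj₁ i<j = searching⇒nonzero j eqj i i<j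
    ... | inj₂ refl = r , eqc
    searching⇒nonzero (suc j) () i i<1+j | suc s

    nonzero⇒searching : ∀ j → NonzeroBelow j → state j ≡ 0
    nonzero⇒searching zero _ = refl
    nonzero⇒searching (suc j) nz rewrite nonzero⇒searching j (λ i i<j → nz i (m≤n⇒m≤1+n i<j)) with nz j ≤-refl
    ... | r , eq rewrite eq = refl

    found : ∀ k → NonzeroBelow k → c k ≡ 1 → ∀ j → k < j → state j ≡ suc (suc k)
    found k nz ck (suc j) k<1+j with m≤n⇒m<n∨m≡n (≤-pred k<1+j)
    ... | inj₁ k<j rewrite found k nz ck j k<j = refl
    ... | inj₂ refl rewrite nonzero⇒searching k nz | ck = refl

    found⁻¹ : ∀ j k → state j ≡ suc (suc k) → k < j × c k ≡ 1 × NonzeroBelow k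
    found⁻¹ (suc j) k eq with state j in eqj
    found⁻¹ (suc j) k eq | suc s with found⁻¹ j k (trans eqj eq)
    ... | k<j , ck , nz = m≤n⇒m≤1+n k<j , ck , nz
    found⁻¹ (suc j) k eq | zero with c j in eqc
    found⁻¹ (suc j) k () | zero | zero
    found⁻¹ (suc j) .j refl | zero | suc zero = ≤-refl , eqc , searching⇒nonzero j eqj
    found⁻¹ (suc j) k () | zero | suc (suc r)

  allPos≤1 : ∀ {m} (cs : Vec ℕ m) → allPos cs ≤ 1
  allPos≤1 [] = ≤-refl
  allPos≤1 (zero ∷ cs) = z≤n
  allPos≤1 (suc c ∷ cs) = ≤-trans (≤-reflexive (+-identityʳ (allPos cs))) (allPos≤1 cs)

  ≤1-*-suc : ∀ {a x r} → a ≤ 1 → a * x ≡ suc r → a ≡ 1 × x ≡ suc r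
  ≤1-*-suc {suc zero} {x} _ eq = refl , trans (sym (+-identityʳ x)) eq
  ≤1-*-suc {suc (suc _)} (s≤s ())

  mutual
    timed-sound : ∀ {n} t (e : Code n) v r → timed t e v ≡ suc r → e [ v ]⇓ r
    timed-sound t zeroC v .0 refl = ev-zero
    timed-sound t succC (x ∷ []) .(suc x) refl = ev-succ
    timed-sound t (projC i) v .(lookup v i) refl = ev-proj
    timed-sound t (compC f gs) v r eq
      with ≤1-*-suc (allPos≤1 (timed* t gs v)) (trans (sym (timed-comp t f gs v)) eq)
    ... | all-halt , f-halts = ev-comp (timed*-sound t gs v all-halt) (timed-sound t f _ r f-halts)
    timed-sound t (precC g h) (k ∷ v) r eq = prec-sound k r (trans (sym (timed-prec t g h k v)) eq)
      where
      prec-sound : ∀ k r → natrec k (timed t g v) (precStep t h v) ≡ suc r → precC g h [ k ∷ v ]⇓ r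
      prec-sound zero r eq = ev-prec0 (timed-sound t g v r eq)
      prec-sound (suc k) r eq with natrec k (timed t g v) (precStep t h v) in eqa
      prec-sound (suc k) r () | zero
      prec-sound (suc k) r eq | suc a =
        ev-precS (prec-sound k a eqa) (timed-sound t h _ r (trans (sym (+-identityʳ _)) eq))
    timed-sound t (muC f) v r eq with Search.found⁻¹ (λ j → timed t f (j ∷ v)) t r (pred≡suc (trans (sym (timed-mu t f v)) eq))
      where
      pred≡suc : ∀ {x} → pred x ≡ suc r → x ≡ suc (suc r)
      pred≡suc {suc x} eq = cong suc eq
    ... | _ , fr , nz = ev-mu (timed-sound t f (r ∷ v) 0 fr)
                               (λ i i<r → proj₁ (nz i i<r) , timed-sound t f (i ∷ v) _ (proj₂ (nz i i<r)))

    timed*-sound : ∀ {n m} t (gs : Vec (Code n) m) v → allPos (timed* t gs v) ≡ 1 → gs [ v ]⇓* map pred (timed* t gs v)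
    timed*-sound t [] v _ = ev-[]
    timed*-sound t (g ∷ gs) v eq with timed t g v in eqg
    timed*-sound t (g ∷ gs) v () | zero
    ... | suc r = ev-∷ (timed-sound t g v r eqg) (timed*-sound t gs v (trans (sym (+-identityʳ _)) eq))

  Eventually : (ℕ → Set) → Set
  Eventually P = ∃ λ T → ∀ t → T ≤ t → P t

  eventually-× : ∀ {P Q : ℕ → Set} → Eventually P → Eventually Q → Eventually (λ t → P t × Q t)
  eventually-× (T , p) (T′ , q) =
    T ⊔ T′ , λ t le → p t (≤-trans (m≤m⊔n T T′) le) , q t (≤-trans (m≤n⊔m T T′) le)

  eventually-nonzeroBelow : ∀ {n} (f : Code (suc n)) v k →
    (∀ j → j < k → ∃ λ r → Eventually (λ t → timed t f (j ∷ v) ≡ suc (suc r))) →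
    Eventually (λ t → Search.NonzeroBelow (λ j → timed t f (j ∷ v)) k)
  eventually-nonzeroBelow f v zero _ = 0 , λ t _ j ()
  eventually-nonzeroBelow f v (suc k) ev
    with eventually-× (eventually-nonzeroBelow f v k (λ j j<k → ev j (m≤n⇒m≤1+n j<k))) (proj₂ (ev k ≤-refl))
  ... | T , below-and-k = T , λ t le j j<1+k → extend t le j (m≤n⇒m<n∨m≡n (≤-pred j<1+k))
    where
    extend : ∀ t → T ≤ t → ∀ j → j < k ⊎ j ≡ k → ∃ λ r → timed t f (j ∷ v) ≡ suc (suc r)
    extend t le j (inj₁ j<k) = proj₁ (below-and-k t le) j j<k
    extend t le j (inj₂ refl) = proj₁ (ev k ≤-refl) , proj₂ (below-and-k t le)

  allPos-suc : ∀ {m} (us : Vec ℕ m) → allPos (map suc us) ≡ 1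
  allPos-suc [] = refl
  allPos-suc (u ∷ us) = trans (+-identityʳ _) (allPos-suc us)

  map-pred-suc : ∀ {m} (us : Vec ℕ m) → map pred (map suc us) ≡ us
  map-pred-suc [] = refl
  map-pred-suc (u ∷ us) = cong (u ∷_) (map-pred-suc us)

  mutual
    timed-complete : ∀ {n} {e : Code n} {v r} → e [ v ]⇓ r → Eventually (λ t → timed t e v ≡ suc r)
    timed-complete ev-zero = 0 , λ t _ → refl
    timed-complete ev-succ = 0 , λ t _ → refl
    timed-complete ev-proj = 0 , λ t _ → refl
    timed-complete {e = compC f gs} {v} (ev-comp {us = us} gs⇓ f⇓) with eventually-× (timed*-complete gs⇓) (timed-complete f⇓)
    ... | T , both = T , λ t le → let gs-ok , f-ok = both t le in
      trans (timed-comp t f gs v)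
        (trans (cong (λ w → allPos w * timed t f (map pred w)) gs-ok)
          (trans (cong₂ (λ a w → a * timed t f w) (allPos-suc us) (map-pred-suc us))
            (trans (+-identityʳ _) f-ok)))
    timed-complete {e = precC g h} {0 ∷ v} (ev-prec0 g⇓) with timed-complete g⇓
    ... | T , g-ok = T , λ t le → trans (timed-prec t g h 0 v) (g-ok t le)
    timed-complete {e = precC g h} {suc k ∷ v} (ev-precS p⇓ h⇓) with eventually-× (timed-complete p⇓) (timed-complete h⇓)
    ... | T , both = T , λ t le → let p-ok , h-ok = both t le in
      trans (timed-prec t g h (suc k) v)
        (trans (cong (precStep t h v k) (trans (sym (timed-prec t g h k v)) p-ok))
          (trans (+-identityʳ _) h-ok))
    timed-complete {e = muC f} {v} (ev-mu {k = k} f0 below)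
      with eventually-× (eventually-nonzeroBelow f v k (λ j j<k → proj₁ (below j j<k) , timed-complete (proj₂ (below j j<k))))
                        (eventually-× (timed-complete f0) (suc k , λ _ le → le))
    ... | T , all = T , λ t le → let nz , fk , k<t = all t le in
      trans (timed-mu t f v) (cong pred (Search.found (λ j → timed t f (j ∷ v)) k nz fk t k<t))

    timed*-complete : ∀ {n m} {gs : Vec (Code n) m} {v rs} → gs [ v ]⇓* rs →
                      Eventually (λ t → timed* t gs v ≡ map suc rs)
    timed*-complete ev-[] = 0 , λ t _ → refl
    timed*-complete (ev-∷ g⇓ gs⇓) with eventually-× (timed-complete g⇓) (timed*-complete gs⇓)
    ... | T , both = T , λ t le → cong₂ _∷_ (proj₁ (both t le)) (proj₂ (both t le))

module BinaryDigits where

  open import Data.Nat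
  open import Data.Nat.Properties
  open import Data.Nat.DivMod
  open import Relation.Binary.PropositionalEquality
  open Sums using (natrec)

  2*n/2≡n : ∀ n → 2 * n / 2 ≡ n
  2*n/2≡n n = trans (cong (_/ 2) (*-comm 2 n)) (m*n/n≡m n 2)

  2*n%2≡0 : ∀ n → 2 * n % 2 ≡ 0
  2*n%2≡0 n = trans (cong (_% 2) (*-comm 2 n)) (m*n%n≡0 n 2)

  [1+2*n]/2≡n : ∀ n → suc (2 * n) / 2 ≡ n
  [1+2*n]/2≡n zero = refl
  [1+2*n]/2≡n (suc n) = trans (cong (λ m → suc m / 2) (*-suc 2 n))
    (trans (m/n≡1+[m∸n]/n {3 + 2 * n} {2} (s≤s (s≤s z≤n))) (cong suc ([1+2*n]/2≡n n)))

  [1+2*n]%2≡1 : ∀ n → suc (2 * n) % 2 ≡ 1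
  [1+2*n]%2≡1 zero = refl
  [1+2*n]%2≡1 (suc n) = trans (cong (λ m → suc m % 2) (*-suc 2 n)) ([1+2*n]%2≡1 n)

  n≡2*[n/2]+n%2 : ∀ n → n ≡ 2 * (n / 2) + n % 2
  n≡2*[n/2]+n%2 n = trans (m≡m%n+[m/n]*n n 2) (trans (+-comm (n % 2) _) (cong (_+ n % 2) (*-comm (n / 2) 2)))

  n%2≤1 : ∀ n → n % 2 ≤ 1
  n%2≤1 n = ≤-pred (m%n<n n 2)

  digit : ℕ → ℕ → ℕ
  digit y i = natrec i y (λ _ a → a / 2) % 2

  digit≤1 : ∀ y i → digit y i ≤ 1
  digit≤1 y i = n%2≤1 (natrec i y (λ _ a → a / 2))

  bit≡digit : ∀ y i → bit y i ≡ digit y i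
  bit≡digit y zero = refl
  bit≡digit y (suc i) = trans (bit≡digit (y / 2) i) (cong (_% 2) (halve-comm i y))
    where
    halve-comm : ∀ i y → natrec i (y / 2) (λ _ a → a / 2) ≡ natrec i y (λ _ a → a / 2) / 2
    halve-comm zero y = refl
    halve-comm (suc i) y = cong (_/ 2) (halve-comm i y)

  bit≡1⇒<y : ∀ y i → bit y i ≡ 1 → i < y
  bit≡1⇒<y zero zero ()
  bit≡1⇒<y (suc y) zero _ = s≤s z≤n
  bit≡1⇒<y y (suc i) bit≡1 with bit≡1⇒<y (y / 2) i bit≡1
  ... | i<y/2 = <-≤-trans (s≤s i<y/2) (m/n<m y 2 {{>-nonZero (≤-trans (s≤s z≤n) (≤-trans i<y/2 (m/n≤m y 2)))}} (s≤s (s≤s z≤n)))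

module Strings where

  open import Data.Nat
  open import Data.Nat.Properties
  open import Data.Nat.DivMod
  open import Data.Nat.Binary.Base using (ℕᵇ; 2[1+_]; 1+[2_]; toℕ; fromℕ) renaming (zero to zeroᵇ)
  open import Data.Nat.Binary.Properties using (toℕ-fromℕ; fromℕ-toℕ)
  open import Data.Bool using (Bool; true; false)
  open import Data.List using ([]; _∷_; length)
  open import Data.Fin using (zero; suc)
  open import Data.Product using (_,_)
  open import Relation.Binary.PropositionalEquality
  open import Relation.Nullary using (yes; no)
  open ZeroOne using (sg; boolToℕ)
  open Sums using (natrec; bsum; bsum-cong)
  open BinaryDigits
  open PrimRec using (PR)
  open OracleExpr

  bitOf : BStr → ℕ → Bool
  bitOf [] i = false
  bitOf (c ∷ σ) zero = c
  bitOf (c ∷ σ) (suc i) = bitOf σ i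

  bitAt : BStr → ℕ → ℕ
  bitAt σ i = boolToℕ (bitOf σ i)

  restrict : Set2ω → ℕ → BStr
  restrict A zero = []
  restrict A (suc N) = A 0 ∷ restrict (λ i → A (suc i)) N

  length-restrict : ∀ A N → length (restrict A N) ≡ N
  length-restrict A zero = refl
  length-restrict A (suc N) = cong suc (length-restrict (λ i → A (suc i)) N)

  bitOf-restrict : ∀ A N i → i < N → bitOf (restrict A N) i ≡ A i
  bitOf-restrict A (suc N) zero _ = refl
  bitOf-restrict A (suc N) (suc i) (s≤s i<N) = bitOf-restrict (λ i → A (suc i)) N i i<N

  restrict≺ : ∀ A N → restrict A N ≺ A
  restrict≺ A zero = _
  restrict≺ A (suc N) = refl , restrict≺ (λ i → A (suc i)) N

  -- In the bijective base-2 coding, str s = [] for s = 0, and otherwise its head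
  -- is the parity of s - 1 and its tail is str ((s - 1) / 2).
  tailCode : ℕ → ℕ
  tailCode s = pred s / 2

  iterTail : ℕ → ℕ → ℕ
  iterTail i s = natrec i s (λ _ → tailCode)

  codeBit : ℕ → ℕ → ℕ
  codeBit s i = pred (iterTail i s) % 2

  codeLength : ℕ → ℕ
  codeLength s = bsum s (λ i → sg (iterTail i s))

  codeBitPR : PR 2
  codeBitPR = exprPR (parityᴱ (predᴱ iterTailᴱ))
    where
    iterTailᴱ : Expr 2
    iterTailᴱ = rec (var zero) (var (suc zero)) (halfᴱ (predᴱ (var (suc zero))))

  codeLengthPR : PR 1
  codeLengthPR = exprPR (sum (var zero) (sgᴱ (rec (var zero) (var (suc zero)) (halfᴱ (predᴱ (var (suc zero)))))))

  private
    iterTail-suc : ∀ i s → iterTail (suc i) s ≡ iterTail i (tailCode s)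
    iterTail-suc zero s = refl
    iterTail-suc (suc i) s = cong tailCode (iterTail-suc i s)

    iterTail-0 : ∀ i → iterTail i 0 ≡ 0
    iterTail-0 zero = refl
    iterTail-0 (suc i) = cong tailCode (iterTail-0 i)

    tail-1+[2_] : ∀ x → tailCode (toℕ 1+[2 x ]) ≡ toℕ x
    tail-1+[2 x ] = 2*n/2≡n (toℕ x)

    tail-2[1+_] : ∀ x → tailCode (toℕ 2[1+ x ]) ≡ toℕ x
    tail-2[1+ x ] = trans (cong (λ n → pred n / 2) (*-suc 2 (toℕ x))) ([1+2*n]/2≡n (toℕ x))

    bitAt-strᵇ : ∀ b i → bitAt (strᵇ b) i ≡ codeBit (toℕ b) i
    bitAt-strᵇ zeroᵇ i rewrite iterTail-0 i = refl
    bitAt-strᵇ 1+[2 x ] zero = sym (2*n%2≡0 (toℕ x))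
    bitAt-strᵇ 1+[2 x ] (suc i) rewrite iterTail-suc i (toℕ 1+[2 x ]) | tail-1+[2 x ] = bitAt-strᵇ x i
    bitAt-strᵇ 2[1+ x ] zero = sym (trans (cong (λ n → pred n % 2) (*-suc 2 (toℕ x))) ([1+2*n]%2≡1 (toℕ x)))
    bitAt-strᵇ 2[1+ x ] (suc i) rewrite iterTail-suc i (toℕ 2[1+ x ]) | tail-2[1+ x ] = bitAt-strᵇ x i

    sg-iterTail : ∀ b i → sg (iterTail i (toℕ b)) ≡ sg (length (strᵇ b) ∸ i)
    sg-iterTail zeroᵇ i rewrite iterTail-0 i | 0∸n≡0 i = refl
    sg-iterTail 1+[2 x ] zero = refl
    sg-iterTail 1+[2 x ] (suc i) rewrite iterTail-suc i (toℕ 1+[2 x ]) | tail-1+[2 x ] = sg-iterTail x i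
    sg-iterTail 2[1+ x ] zero = refl
    sg-iterTail 2[1+ x ] (suc i) rewrite iterTail-suc i (toℕ 2[1+ x ]) | tail-2[1+ x ] = sg-iterTail x i

    length-strᵇ≤ : ∀ b → length (strᵇ b) ≤ toℕ b
    length-strᵇ≤ zeroᵇ = z≤n
    length-strᵇ≤ 1+[2 x ] = s≤s (≤-trans (length-strᵇ≤ x) (m≤m+n (toℕ x) _))
    length-strᵇ≤ 2[1+ x ] rewrite *-suc 2 (toℕ x) =
      s≤s (≤-trans (length-strᵇ≤ x) (≤-trans (m≤m+n (toℕ x) _) (n≤1+n _)))

    bsum-sg[L∸i] : ∀ s L → bsum s (λ i → sg (L ∸ i)) ≡ s ⊓ L
    bsum-sg[L∸i] zero L = refl
    bsum-sg[L∸i] (suc s) L with L ≤? s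
    ... | yes L≤s rewrite bsum-sg[L∸i] s L | m≤n⇒m∸n≡0 L≤s | m≥n⇒m⊓n≡n L≤s | m≥n⇒m⊓n≡n (m≤n⇒m≤1+n L≤s) = +-identityʳ L
    ... | no L≰s = begin
      bsum s (λ i → sg (L ∸ i)) + sg (L ∸ s) ≡⟨ cong₂ _+_ (bsum-sg[L∸i] s L) (sg-pos (m<n⇒0<n∸m s<L)) ⟩
      s ⊓ L + 1                              ≡⟨ cong (_+ 1) (m≤n⇒m⊓n≡m (<⇒≤ s<L)) ⟩
      s + 1                                  ≡⟨ +-comm s 1 ⟩
      suc s                                  ≡⟨ m≤n⇒m⊓n≡m s<L ⟨
      suc s ⊓ L                              ∎
      where
      open ≡-Reasoning
      s<L : s < L
      s<L = ≰⇒> L≰s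
      sg-pos : ∀ {n} → 0 < n → sg n ≡ 1
      sg-pos {suc n} _ = refl

  bitAt-str : ∀ s i → bitAt (str s) i ≡ codeBit s i
  bitAt-str s i = trans (bitAt-strᵇ (fromℕ s) i) (cong (λ n → codeBit n i) (toℕ-fromℕ s))

  length-str : ∀ s → length (str s) ≡ codeLength s
  length-str s = sym (begin
    bsum s (λ i → sg (iterTail i s))            ≡⟨ bsum-cong s (λ i → trans (cong (λ n → sg (iterTail i n)) (sym (toℕ-fromℕ s)))
                                                                         (sg-iterTail (fromℕ s) i)) ⟩
    bsum s (λ i → sg (length (str s) ∸ i))      ≡⟨ bsum-sg[L∸i] s (length (str s)) ⟩
    s ⊓ length (str s)                          ≡⟨ m≥n⇒m⊓n≡n (subst (length (str s) ≤_) (toℕ-fromℕ s) (length-strᵇ≤ (fromℕ s))) ⟩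
    length (str s)                              ∎)
    where open ≡-Reasoning

  private
    encodeᵇ : BStr → ℕᵇ
    encodeᵇ [] = zeroᵇ
    encodeᵇ (true ∷ σ) = 2[1+ encodeᵇ σ ]
    encodeᵇ (false ∷ σ) = 1+[2 encodeᵇ σ ]

    strᵇ-encodeᵇ : ∀ σ → strᵇ (encodeᵇ σ) ≡ σ
    strᵇ-encodeᵇ [] = refl
    strᵇ-encodeᵇ (true ∷ σ) = cong (true ∷_) (strᵇ-encodeᵇ σ)
    strᵇ-encodeᵇ (false ∷ σ) = cong (false ∷_) (strᵇ-encodeᵇ σ)

  encode : BStr → ℕ
  encode σ = toℕ (encodeᵇ σ)

  str-encode : ∀ σ → str (encode σ) ≡ σ
  str-encode σ = trans (cong strᵇ (fromℕ-toℕ (encodeᵇ σ))) (strᵇ-encodeᵇ σ)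

module Cube where

  open import Data.Nat
  open import Data.Nat.Properties
  open import Data.Bool using (Bool; true; false; not; T?)
  open import Data.Bool.ListAction using (any)
  open import Data.List using (List; []; _∷_; length; filter; map; _++_)
  open import Data.Empty using (⊥-elim)
  open import Function using (_∘_)
  open import Relation.Binary.PropositionalEquality
  open import Algebra.Properties.CommutativeSemigroup +-commutativeSemigroup using (interchange)
  open Sums using (bsum)
  open ZeroOne using (boolToℕ)
  open Strings using (bitOf)

  cubeSum : ℕ → (BStr → ℕ) → ℕ
  cubeSum zero w = w []
  cubeSum (suc M) w = cubeSum M (λ τ → w (true ∷ τ)) + cubeSum M (λ τ → w (false ∷ τ))

  private
    count : (BStr → Bool) → List BStr → ℕ
    count P [] = 0
    count P (τ ∷ τs) = boolToℕ (P τ) + count P τs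

    length-filter : ∀ P τs → length (filter (λ τ → T? (P τ)) τs) ≡ count P τs
    length-filter P [] = refl
    length-filter P (τ ∷ τs) with P τ
    ... | true = cong suc (length-filter P τs)
    ... | false = length-filter P τs

    count-++ : ∀ P τs τs′ → count P (τs ++ τs′) ≡ count P τs + count P τs′
    count-++ P [] τs′ = refl
    count-++ P (τ ∷ τs) τs′ = trans (cong (boolToℕ (P τ) +_) (count-++ P τs τs′)) (sym (+-assoc (boolToℕ (P τ)) _ _))

    count-map : ∀ P f τs → count P (map f τs) ≡ count (P ∘ f) τs
    count-map P f [] = refl
    count-map P f (τ ∷ τs) = cong (boolToℕ (P (f τ)) +_) (count-map P f τs)

    count-allStr : ∀ M P → count P (allStr M) ≡ cubeSum M (boolToℕ ∘ P)
    count-allStr zero P = +-identityʳ _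
    count-allStr (suc M) P = trans (count-++ P (map (true ∷_) (allStr M)) (map (false ∷_) (allStr M)))
      (cong₂ _+_ (trans (count-map P (true ∷_) (allStr M)) (count-allStr M _))
                 (trans (count-map P (false ∷_) (allStr M)) (count-allStr M _)))

  countCov≡cubeSum : ∀ N L → countCov N L ≡ cubeSum N (λ τ → boolToℕ (any (λ σ → isPrefix σ τ) L))
  countCov≡cubeSum N L = trans (length-filter _ (allStr N)) (count-allStr N _)

  cubeSum-cong : ∀ M {w w′ : BStr → ℕ} → (∀ τ → length τ ≡ M → w τ ≡ w′ τ) → cubeSum M w ≡ cubeSum M w′
  cubeSum-cong zero w≗w′ = w≗w′ [] refl
  cubeSum-cong (suc M) w≗w′ =
    cong₂ _+_ (cubeSum-cong M (λ τ e → w≗w′ (true ∷ τ) (cong suc e))) (cubeSum-cong M (λ τ e → w≗w′ (false ∷ τ) (cong suc e)))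

  cubeSum-mono-≤ : ∀ M {w w′ : BStr → ℕ} → (∀ τ → length τ ≡ M → w τ ≤ w′ τ) → cubeSum M w ≤ cubeSum M w′
  cubeSum-mono-≤ zero w≤w′ = w≤w′ [] refl
  cubeSum-mono-≤ (suc M) w≤w′ =
    +-mono-≤ (cubeSum-mono-≤ M (λ τ e → w≤w′ (true ∷ τ) (cong suc e))) (cubeSum-mono-≤ M (λ τ e → w≤w′ (false ∷ τ) (cong suc e)))

  cubeSum-+ : ∀ M (w w′ : BStr → ℕ) → cubeSum M (λ τ → w τ + w′ τ) ≡ cubeSum M w + cubeSum M w′
  cubeSum-+ zero w w′ = refl
  cubeSum-+ (suc M) w w′
    rewrite cubeSum-+ M (λ τ → w (true ∷ τ)) (λ τ → w′ (true ∷ τ)) | cubeSum-+ M (λ τ → w (false ∷ τ)) (λ τ → w′ (false ∷ τ)) =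
    interchange (cubeSum M (λ τ → w (true ∷ τ))) _ _ _

  cubeSum-* : ∀ M c (w : BStr → ℕ) → cubeSum M (λ τ → c * w τ) ≡ c * cubeSum M w
  cubeSum-* zero c w = refl
  cubeSum-* (suc M) c w rewrite cubeSum-* M c (λ τ → w (true ∷ τ)) | cubeSum-* M c (λ τ → w (false ∷ τ)) =
    sym (*-distribˡ-+ c _ _)

  cubeSum-0 : ∀ M → cubeSum M (λ _ → 0) ≡ 0
  cubeSum-0 zero = refl
  cubeSum-0 (suc M) = cong₂ _+_ (cubeSum-0 M) (cubeSum-0 M)

  cubeSum-1 : ∀ M → cubeSum M (λ _ → 1) ≡ 2 ^ M
  cubeSum-1 zero = refl
  cubeSum-1 (suc M) rewrite cubeSum-1 M = cong (2 ^ M +_) (sym (+-identityʳ (2 ^ M)))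

  cubeSum-bsum : ∀ M n (F : BStr → ℕ → ℕ) → cubeSum M (λ τ → bsum n (F τ)) ≡ bsum n (λ k → cubeSum M (λ τ → F τ k))
  cubeSum-bsum M zero F = cubeSum-0 M
  cubeSum-bsum M (suc n) F =
    trans (cubeSum-+ M (λ τ → bsum n (F τ)) (λ τ → F τ n)) (cong (_+ cubeSum M (λ τ → F τ n)) (cubeSum-bsum M n F))

  flip : ℕ → BStr → BStr
  flip x [] = []
  flip zero (c ∷ τ) = not c ∷ τ
  flip (suc x) (c ∷ τ) = c ∷ flip x τ

  cubeSum-flip : ∀ x M (w : BStr → ℕ) → cubeSum M (w ∘ flip x) ≡ cubeSum M w
  cubeSum-flip x zero w = refl
  cubeSum-flip zero (suc M) w = +-comm (cubeSum M (λ τ → w (false ∷ τ))) (cubeSum M (λ τ → w (true ∷ τ)))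
  cubeSum-flip (suc x) (suc M) w = cong₂ _+_ (cubeSum-flip x M (λ τ → w (true ∷ τ))) (cubeSum-flip x M (λ τ → w (false ∷ τ)))

  length-flip : ∀ x τ → length (flip x τ) ≡ length τ
  length-flip x [] = refl
  length-flip zero (c ∷ τ) = refl
  length-flip (suc x) (c ∷ τ) = cong suc (length-flip x τ)

  flip-involutive : ∀ x τ → flip x (flip x τ) ≡ τ
  flip-involutive x [] = refl
  flip-involutive zero (true ∷ τ) = refl
  flip-involutive zero (false ∷ τ) = refl
  flip-involutive (suc x) (c ∷ τ) = cong (c ∷_) (flip-involutive x τ)

  bitOf-flip-≢ : ∀ x τ y → y ≢ x → bitOf (flip x τ) y ≡ bitOf τ y
  bitOf-flip-≢ x [] y _ = refl
  bitOf-flip-≢ zero (c ∷ τ) zero y≢x = ⊥-elim (y≢x refl)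
  bitOf-flip-≢ zero (c ∷ τ) (suc y) _ = refl
  bitOf-flip-≢ (suc x) (c ∷ τ) zero _ = refl
  bitOf-flip-≢ (suc x) (c ∷ τ) (suc y) y≢x = bitOf-flip-≢ x τ y (y≢x ∘ cong suc)

  bitOf-flip-≡ : ∀ x τ → x < length τ → bitOf (flip x τ) x ≡ not (bitOf τ x)
  bitOf-flip-≡ zero (c ∷ τ) _ = refl
  bitOf-flip-≡ (suc x) (c ∷ τ) (s≤s x<len) = bitOf-flip-≡ x τ x<len

module FlipCount where

  open import Data.Nat
  open import Data.Nat.Properties
  open import Data.Bool using (Bool; true; false; not; _∧_; _∨_)
  open import Data.Bool.Properties using (∧-identityʳ; ∧-zeroʳ)
  open import Data.List using (length)
  open import Data.Product using (_×_; _,_)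
  open import Data.Sum using (inj₁; inj₂)
  open import Relation.Binary.PropositionalEquality
  open import Data.Nat.Tactic.RingSolver using (solve-∀)
  open Sums using (bsum; bsum-cong)
  open ZeroOne using (boolToℕ; boolToℕ≤1; ≤ᵇ-true)
  open Strings using (bitOf)
  open Cube

  nPicked : (BStr → ℕ → Bool) → ℕ → BStr → ℕ
  nPicked picked j τ = bsum j (λ x → boolToℕ (picked τ x))

  private
    agrees : Bool → Bool → Bool
    agrees true c = c
    agrees false c = not c

    agrees-not : ∀ a c → agrees (not a) c ≡ not (agrees a c)
    agrees-not true c = refl
    agrees-not false true = refl
    agrees-not false false = refl

    agrees-refl : ∀ a → agrees a a ≡ true
    agrees-refl true = refl
    agrees-refl false = refl

    allBelow : ℕ → (ℕ → Bool) → Bool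
    allBelow zero p = true
    allBelow (suc j) p = allBelow j p ∧ p j

    allBelow-cong : ∀ j {p q : ℕ → Bool} → (∀ x → x < j → p x ≡ q x) → allBelow j p ≡ allBelow j q
    allBelow-cong zero _ = refl
    allBelow-cong (suc j) p≗q = cong₂ _∧_ (allBelow-cong j (λ x x<j → p≗q x (m≤n⇒m≤1+n x<j))) (p≗q j ≤-refl)

    allBelow-true : ∀ j {p : ℕ → Bool} → (∀ x → x < j → p x ≡ true) → allBelow j p ≡ true
    allBelow-true zero _ = refl
    allBelow-true (suc j) {p} all rewrite allBelow-true j (λ x x<j → all x (m≤n⇒m≤1+n x<j)) = all j ≤-refl

  -- A guesser who reads a string τ of length M and picks positions whose bits
  -- it claims to know, such that flipping a picked bit does not change the
  -- picks, is right on m picks for at most 2^(M ∸ m) strings. The proof tracks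
  -- the total over τ of 2^(picks below j) for the τ still right below j;
  -- pairing τ with flip j τ shows that this total does not depend on j.
  module _ (M m : ℕ) (picked : BStr → ℕ → Bool) (target : ℕ → Bool)
    (picked-flip : ∀ τ → length τ ≡ M → ∀ x → picked τ x ≡ true → ∀ y → picked (flip x τ) y ≡ picked τ y)
    (picked-< : ∀ τ → length τ ≡ M → ∀ x → picked τ x ≡ true → x < M) where

    private
      consistent : BStr → ℕ → Bool
      consistent τ x = not (picked τ x) ∨ agrees (bitOf τ x) (target x)

      good : ℕ → BStr → Bool
      good j τ = (m ≤ᵇ nPicked picked M τ) ∧ allBelow j (consistent τ)

      weight : ℕ → BStr → ℕ
      weight j τ = boolToℕ (good j τ) * 2 ^ nPicked picked j τ

      unpicked hit miss : ℕ → BStr → ℕ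
      unpicked j τ = boolToℕ (not (picked τ j)) * weight j τ
      hit j τ = boolToℕ (picked τ j ∧ agrees (bitOf τ j) (target j)) * weight j τ
      miss j τ = boolToℕ (picked τ j ∧ not (agrees (bitOf τ j) (target j))) * weight j τ

      weight-split : ∀ j τ → weight j τ ≡ unpicked j τ + hit j τ + miss j τ
      weight-split j τ with picked τ j | agrees (bitOf τ j) (target j)
      ... | false | _ = only-unpicked (weight j τ)
        where
        only-unpicked : ∀ w → w ≡ 1 * w + 0 * w + 0 * w
        only-unpicked = solve-∀
      ... | true | true = only-hit (weight j τ)
        where
        only-hit : ∀ w → w ≡ 0 * w + 1 * w + 0 * w
        only-hit = solve-∀
      ... | true | false = only-miss (weight j τ)
        where
        only-miss : ∀ w → w ≡ 0 * w + 0 * w + 1 * w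
        only-miss = solve-∀

      weight-suc : ∀ j τ → weight (suc j) τ ≡ unpicked j τ + 2 * hit j τ
      weight-suc j τ with picked τ j | agrees (bitOf τ j) (target j)
      ... | false | _ rewrite ∧-identityʳ (allBelow j (consistent τ)) | +-identityʳ (nPicked picked j τ) =
        sym (trans (+-identityʳ _) (+-identityʳ _))
      ... | true | true rewrite ∧-identityʳ (allBelow j (consistent τ)) | +-comm (nPicked picked j τ) 1 =
        doubled (boolToℕ (good j τ)) (2 ^ nPicked picked j τ)
        where
        doubled : ∀ g p → g * (2 * p) ≡ 0 * (g * p) + 2 * (1 * (g * p))
        doubled = solve-∀
      ... | true | false rewrite ∧-zeroʳ (allBelow j (consistent τ)) | ∧-zeroʳ (m ≤ᵇ nPicked picked M τ) = refl

      miss≡hit∘flip : ∀ j τ → length τ ≡ M → miss j τ ≡ hit j (flip j τ)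
      miss≡hit∘flip j τ len with picked τ j in picked-j
      ... | true = trans
        (cong₂ (λ a c → boolToℕ (a ∧ c) * weight j τ) (sym (trans (flip-same j) picked-j)) (sym flip-disagrees))
        (cong₂ (λ g c → boolToℕ (picked (flip j τ) j ∧ agrees (bitOf (flip j τ) j) (target j)) * (boolToℕ g * 2 ^ c))
               (sym good-flip) (sym (nPicked-flip j)))
        where
        flip-same : ∀ y → picked (flip j τ) y ≡ picked τ y
        flip-same = picked-flip τ len j picked-j
        nPicked-flip : ∀ k → nPicked picked k (flip j τ) ≡ nPicked picked k τ
        nPicked-flip k = bsum-cong k (λ x → cong boolToℕ (flip-same x))
        flip-disagrees : agrees (bitOf (flip j τ) j) (target j) ≡ not (agrees (bitOf τ j) (target j))
        flip-disagrees = trans (cong (λ b → agrees b (target j)) (bitOf-flip-≡ j τ (subst (j <_) (sym len) (picked-< τ len j picked-j))))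
                               (agrees-not (bitOf τ j) (target j))
        good-flip : good j (flip j τ) ≡ good j τ
        good-flip = cong₂ _∧_ (cong (m ≤ᵇ_) (nPicked-flip M))
          (allBelow-cong j (λ x x<j → cong₂ (λ a c → not a ∨ agrees c (target x))
                                            (flip-same x) (bitOf-flip-≢ j τ x (λ x≡j → <-irrefl x≡j x<j))))
      ... | false with picked (flip j τ) j in picked-flip-j
      ...   | false = refl
      ...   | true with () ← trans (sym picked-j)
                     (trans (cong (λ σ → picked σ j) (sym (flip-involutive j τ)))
                            (trans (picked-flip (flip j τ) (trans (length-flip j τ) len) j picked-flip-j j) picked-flip-j))

      total : ℕ → ℕ
      total j = cubeSum M (weight j)

      total-suc : ∀ j → total (suc j) ≡ total j
      total-suc j = begin
        cubeSum M (weight (suc j))                                  ≡⟨ cubeSum-cong M (λ τ _ → weight-suc j τ) ⟩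
        cubeSum M (λ τ → unpicked j τ + 2 * hit j τ)                ≡⟨ cubeSum-+ M (unpicked j) (λ τ → 2 * hit j τ) ⟩
        cubeSum M (unpicked j) + cubeSum M (λ τ → 2 * hit j τ)      ≡⟨ cong (cubeSum M (unpicked j) +_) (cubeSum-* M 2 (hit j)) ⟩
        U + 2 * H                                                   ≡⟨ cong (λ z → U + (H + z)) (+-identityʳ H) ⟩
        U + (H + H)                                                 ≡⟨ +-assoc U H H ⟨
        U + H + H                                                   ≡⟨ cong (U + H +_) (cubeSum-flip j M (hit j)) ⟨
        U + H + cubeSum M (λ τ → hit j (flip j τ))                  ≡⟨ cong (U + H +_) (cubeSum-cong M (λ τ len → sym (miss≡hit∘flip j τ len))) ⟩
        U + H + cubeSum M (miss j)                                  ≡⟨ cong (_+ cubeSum M (miss j)) (cubeSum-+ M (unpicked j) (hit j)) ⟨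
        cubeSum M (λ τ → unpicked j τ + hit j τ) + cubeSum M (miss j) ≡⟨ cubeSum-+ M (λ τ → unpicked j τ + hit j τ) (miss j) ⟨
        cubeSum M (λ τ → unpicked j τ + hit j τ + miss j τ)         ≡⟨ cubeSum-cong M (λ τ _ → weight-split j τ) ⟨
        cubeSum M (weight j)                                        ∎
        where
        open ≡-Reasoning
        U = cubeSum M (unpicked j)
        H = cubeSum M (hit j)

      total≡total0 : ∀ j → total j ≡ total 0
      total≡total0 zero = refl
      total≡total0 (suc j) = trans (total-suc j) (total≡total0 j)

      total0≤2^M : total 0 ≤ 2 ^ M
      total0≤2^M = ≤-trans (cubeSum-mono-≤ M (λ τ _ → ≤-trans (≤-reflexive (*-identityʳ _)) (boolToℕ≤1 (good 0 τ))))
                           (≤-reflexive (cubeSum-1 M))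

      consistent-true : ∀ τ → (∀ x → x < M → picked τ x ≡ true → bitOf τ x ≡ target x) → ∀ x → x < M → consistent τ x ≡ true
      consistent-true τ right x x<M with picked τ x in picked-x
      ... | false = refl
      ... | true = trans (cong (λ b → agrees b (target x)) (right x x<M picked-x)) (agrees-refl (target x))

    guesses-bound : ∀ (P : BStr → ℕ) → (∀ τ → P τ ≤ 1) →
      (∀ τ → length τ ≡ M → 1 ≤ P τ → m ≤ nPicked picked M τ × (∀ x → x < M → picked τ x ≡ true → bitOf τ x ≡ target x)) →
      cubeSum M P * 2 ^ m ≤ 2 ^ M
    guesses-bound P P≤1 right = begin
      cubeSum M P * 2 ^ m           ≡⟨ trans (*-comm _ (2 ^ m)) (sym (cubeSum-* M (2 ^ m) P)) ⟩
      cubeSum M (λ τ → 2 ^ m * P τ) ≤⟨ cubeSum-mono-≤ M P≤weight ⟩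
      total M                       ≡⟨ total≡total0 M ⟩
      total 0                       ≤⟨ total0≤2^M ⟩
      2 ^ M                         ∎
      where
      open ≤-Reasoning
      P≤weight : ∀ τ → length τ ≡ M → 2 ^ m * P τ ≤ weight M τ
      P≤weight τ len with n≤1⇒n≡0∨n≡1 (P≤1 τ)
      ... | inj₁ P≡0 = ≤-trans (≤-reflexive (trans (cong (2 ^ m *_) P≡0) (*-zeroʳ (2 ^ m)))) z≤n
      ... | inj₂ P≡1 with right τ len (≤-reflexive (sym P≡1))
      ...   | m≤n , bits-right rewrite P≡1 | ≤ᵇ-true m≤n | allBelow-true M (consistent-true τ bits-right) =
        ≤-trans (≤-reflexive (*-identityʳ _)) (≤-trans (^-monoʳ-≤ 2 m≤n) (≤-reflexive (sym (+-identityʳ _))))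

module Geometric where

  open import Data.Nat
  open import Data.Nat.Properties
  open import Relation.Binary.PropositionalEquality
  open import Data.Nat.Tactic.RingSolver using (solve-∀)
  open Sums using (bsum; bsum-monoˡ-≤; terms≡0⇒bsum≡0)

  geometric-tail : ∀ (c : ℕ → ℕ) X K → (∀ k → c k * 2 ^ k ≤ X) → (∀ k → k ≤ K → c k ≡ 0) →
                   ∀ n → bsum n c * 2 ^ K ≤ X
  geometric-tail c X K c≤ c≡0 n = *-cancelʳ-≤ (bsum n c * 2 ^ K) X (2 ^ suc n) {{m^n≢0 2 (suc n)}} (begin
    bsum n c * 2 ^ K * 2 ^ suc n             ≤⟨ *-monoˡ-≤ (2 ^ suc n) (*-monoˡ-≤ (2 ^ K) (bsum-monoˡ-≤ c (m≤n+m n (suc K)))) ⟩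
    bsum (suc K + n) c * 2 ^ K * 2 ^ suc n   ≡⟨ *-assoc (bsum (suc K + n) c) (2 ^ K) (2 ^ suc n) ⟩
    bsum (suc K + n) c * (2 ^ K * 2 ^ suc n) ≡⟨ cong (λ p → bsum (suc K + n) c * p) (^-distribˡ-+-* 2 K (suc n)) ⟨
    bsum (suc K + n) c * 2 ^ (K + suc n)     ≡⟨ cong (λ p → bsum (suc K + n) c * 2 ^ p) (+-suc K n) ⟩
    bsum (suc K + n) c * 2 ^ (suc K + n)     ≤⟨ m≤m+n _ (2 * X) ⟩
    bsum (suc K + n) c * 2 ^ (suc K + n) + 2 * X ≤⟨ partial n ⟩
    X * 2 ^ suc n                            ∎)
    where
    open ≤-Reasoning
    partial : ∀ d → bsum (suc K + d) c * 2 ^ (suc K + d) + 2 * X ≤ X * 2 ^ suc d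
    partial zero rewrite +-identityʳ K | terms≡0⇒bsum≡0 (suc K) (λ k k≤K → c≡0 k (≤-pred k≤K)) =
      ≤-reflexive (*-comm 2 X)
    partial (suc d) = begin
      bsum (suc K + suc d) c * 2 ^ (suc K + suc d) + 2 * X ≡⟨ cong (λ n → bsum n c * 2 ^ n + 2 * X) (+-suc (suc K) d) ⟩
      (S + c N) * (2 * P) + 2 * X                          ≡⟨ expand S (c N) P X ⟩
      2 * (S * P) + 2 * (c N * P) + 2 * X                  ≤⟨ +-monoˡ-≤ (2 * X) (+-monoʳ-≤ (2 * (S * P)) (*-monoʳ-≤ 2 (c≤ N))) ⟩
      2 * (S * P) + 2 * X + 2 * X                          ≡⟨ regroup (S * P) X ⟩
      2 * (S * P + 2 * X)                                  ≤⟨ *-monoʳ-≤ 2 (partial d) ⟩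
      2 * (X * 2 ^ suc d)                                  ≡⟨ *-comm-middle X (2 ^ suc d) ⟩
      X * 2 ^ suc (suc d)                                  ∎
      where
      N = suc K + d
      S = bsum N c
      P = 2 ^ N
      expand : ∀ s a p x → (s + a) * (2 * p) + 2 * x ≡ 2 * (s * p) + 2 * (a * p) + 2 * x
      expand = solve-∀
      regroup : ∀ a x → 2 * a + 2 * x + 2 * x ≡ 2 * (a + 2 * x)
      regroup = solve-∀
      *-comm-middle : ∀ x q → 2 * (x * q) ≡ x * (2 * q)
      *-comm-middle = solve-∀

module BoundedSearch where

  open import Data.Nat
  open import Data.Nat.Properties
  open import Data.Bool using (Bool; true; false; if_then_else_)
  open import Relation.Binary.PropositionalEquality

  firstBelow : (ℕ → Bool) → ℕ → ℕ
  firstBelow p zero = 0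
  firstBelow p (suc n) = if p 0 then 0 else suc (firstBelow (λ i → p (suc i)) n)

  firstBelow-found : ∀ p n → firstBelow p n < n → p (firstBelow p n) ≡ true
  firstBelow-found p (suc n) lt with p 0 in p0
  ... | true = p0
  ... | false = firstBelow-found (λ i → p (suc i)) n (≤-pred lt)

  firstBelow-minimal : ∀ p n i → p i ≡ true → i < n → firstBelow p n ≤ i
  firstBelow-minimal p (suc n) i pi i<1+n with p 0 in p0
  ... | true = z≤n
  firstBelow-minimal p (suc n) zero pi _ | false with () ← trans (sym p0) pi
  firstBelow-minimal p (suc n) (suc i) pi (s≤s i<n) | false = s≤s (firstBelow-minimal (λ i → p (suc i)) n i pi i<n)

  firstBelow-cong : ∀ {p q} n → (∀ i → p i ≡ q i) → firstBelow p n ≡ firstBelow q n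
  firstBelow-cong zero _ = refl
  firstBelow-cong {p} {q} (suc n) p≗q rewrite p≗q 0 with q 0
  ... | true = refl
  ... | false = cong suc (firstBelow-cong n (λ i → p≗q (suc i)))

module Test where

  open import Data.Nat
  open import Data.Fin using (zero; suc)
  open import Data.Vec using ([]; _∷_)
  open import Relation.Binary.PropositionalEquality
  open ZeroOne using (sg; χ≤)
  open Sums using (bsum)
  open BinaryDigits using (digit)
  open OracleExpr
  open Timed using (timed; timedPR)

  -- The test read off a string with bits b and length N (or off A itself). An
  -- odd x is eligible when b has an even element in [2⌊x/4⌋, x), and Y is b
  -- without its eligible elements; gap k p says that b vanishes on the numbers
  -- ≡ p mod 2 in [2k, 4k + 1]. inG e m decides G_m, with e the operator Γ.
  module Spec (b : ℕ → ℕ) (N : ℕ) where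

    eligible : ℕ → ℕ
    eligible x = x % 2 * sg (bsum (suc (x / 2) ∸ x / 2 / 2) (λ i → b (2 * (x / 2 / 2 + i))))

    inY : ℕ → ℕ
    inY i = b i * (1 ∸ eligible i)

    D⊆Y : ℕ → ℕ
    D⊆Y y = 1 ∸ sg (bsum y (λ i → digit y i * (1 ∸ inY i)))

    enumerated : Code 2 → ℕ → ℕ → ℕ
    enumerated e u x = eligible x * sg (bsum u (λ y → D⊆Y y * sg (bsum u (λ t → sg (timed t e (x ∷ y ∷ []))))))

    nEnumerated : Code 2 → ℕ → ℕ
    nEnumerated e u = bsum u (enumerated e u)

    enumerated⊆b : Code 2 → ℕ → ℕ
    enumerated⊆b e u = 1 ∸ sg (bsum u (λ x → enumerated e u x * (1 ∸ b x)))

    guessesRight : Code 2 → ℕ → ℕ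
    guessesRight e m = sg (bsum (suc N) (λ u → χ≤ m (nEnumerated e u) * enumerated⊆b e u))

    gap : ℕ → ℕ → ℕ
    gap k p = χ≤ (suc (4 * k + p)) N * (1 ∸ sg (bsum (suc k) (λ i → b (2 * (k + i) + p))))

    gapFrom : ℕ → ℕ
    gapFrom K = sg (bsum (suc N) (λ k → χ≤ K k * (gap k 0 + gap k 1)))

    inG : Code 2 → ℕ → ℕ
    inG e m = sg (guessesRight e (suc m) + gapFrom (m + 3))

  module Program (e : Code 2) where
    private
      v0 : ∀ {n} → Expr (suc n)
      v0 = var zero
      v1 : ∀ {n} → Expr (2 + n)
      v1 = var (suc zero)
      v2 : ∀ {n} → Expr (3 + n)
      v2 = var (suc (suc zero))
      v3 : ∀ {n} → Expr (4 + n)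
      v3 = var (suc (suc (suc zero)))

      χ≤ᴱ : ∀ {n} → Expr n → Expr n → Expr n
      χ≤ᴱ a c = lit 1 ∸ᴱ (a ∸ᴱ c)

      digitᴱ : Expr 2
      digitᴱ = parityᴱ (rec v1 v0 (halfᴱ v1))

      eligibleᴱ : Expr 1
      eligibleᴱ = parityᴱ v0 *ᴱ sgᴱ (sum (sucᴱ (halfᴱ v0) ∸ᴱ halfᴱ (halfᴱ v0))
                                          (oracle (lit 2 *ᴱ (halfᴱ (halfᴱ v1) +ᴱ v0))))

      inYᴱ : Expr 1
      inYᴱ = oracle v0 *ᴱ (lit 1 ∸ᴱ sub eligibleᴱ (v0 ∷ []))

      D⊆Yᴱ : Expr 1
      D⊆Yᴱ = lit 1 ∸ᴱ sgᴱ (sum v0 (sub digitᴱ (v1 ∷ v0 ∷ []) *ᴱ (lit 1 ∸ᴱ sub inYᴱ (v0 ∷ []))))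

      enumeratedᴱ : Expr 2
      enumeratedᴱ = sub eligibleᴱ (v1 ∷ []) *ᴱ sgᴱ (sum v0 (sub D⊆Yᴱ (v0 ∷ [])
                      *ᴱ sgᴱ (sum v1 (sgᴱ (prim (timedPR e) (v0 ∷ v3 ∷ v1 ∷ []))))))

      nEnumeratedᴱ : Expr 1
      nEnumeratedᴱ = sum v0 (sub enumeratedᴱ (v1 ∷ v0 ∷ []))

      enumerated⊆bᴱ : Expr 1
      enumerated⊆bᴱ = lit 1 ∸ᴱ sgᴱ (sum v0 (sub enumeratedᴱ (v1 ∷ v0 ∷ []) *ᴱ (lit 1 ∸ᴱ oracle v0)))

      guessesRightᴱ : Expr 1
      guessesRightᴱ = sgᴱ (sum (sucᴱ oracleLen) (χ≤ᴱ v1 (sub nEnumeratedᴱ (v0 ∷ [])) *ᴱ sub enumerated⊆bᴱ (v0 ∷ [])))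

      gapᴱ : Expr 2
      gapᴱ = χ≤ᴱ (sucᴱ (lit 4 *ᴱ v0 +ᴱ v1)) oracleLen
             *ᴱ (lit 1 ∸ᴱ sgᴱ (sum (sucᴱ v0) (oracle (lit 2 *ᴱ (v1 +ᴱ v0) +ᴱ v2))))

      gapFromᴱ : Expr 1
      gapFromᴱ = sgᴱ (sum (sucᴱ oracleLen) (χ≤ᴱ v1 v0 *ᴱ (sub gapᴱ (v0 ∷ lit 0 ∷ []) +ᴱ sub gapᴱ (v0 ∷ lit 1 ∷ []))))

    inGᴱ : Expr 1
    inGᴱ = sgᴱ (sub guessesRightᴱ (sucᴱ v0 ∷ []) +ᴱ sub gapFromᴱ (v0 +ᴱ lit 3 ∷ []))

    ⟦inGᴱ⟧ : ∀ b N m → Sem.⟦_⟧ b N inGᴱ (m ∷ []) ≡ Spec.inG b N e m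
    ⟦inGᴱ⟧ b N m = refl

module TestProps where

  open import Data.Nat
  open import Data.Nat.Properties
  open import Data.Nat.DivMod
  open import Data.Product using (∃; _×_; _,_; proj₁)
  open import Data.Sum using (inj₁; inj₂)
  open import Data.Vec using ([]; _∷_)
  open import Relation.Binary.PropositionalEquality
  open import Relation.Nullary using (yes; no; contradiction)
  open import Data.Nat.Tactic.RingSolver using (solve-∀)
  open ZeroOne
  open Sums
  open BinaryDigits
  open Timed using (timed)
  open Test

  eligible-window : ∀ x i → i < suc (x / 2) ∸ x / 2 / 2 → 2 * (x / 2 / 2 + i) ≤ x
  eligible-window x i i<w = ≤-trans (*-monoʳ-≤ 2 q+i≤h) 2h≤x
    where
    h = x / 2
    q = h / 2
    q+i≤h : q + i ≤ h
    q+i≤h = ≤-pred (subst (_≤ suc h) (trans (+-comm (suc i) q) (+-suc q i))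
                          (m≤o∸n⇒m+n≤o (suc i) (≤-trans (m/n≤m h 2) (n≤1+n h)) i<w))
    2h≤x : 2 * h ≤ x
    2h≤x = subst (_≤ x) (*-comm h 2) (m/n*n≤m x 2)

  gap-window : ∀ k i p → i < suc k → 2 * (k + i) + p ≤ 4 * k + p
  gap-window k i p i≤k = +-monoˡ-≤ p (≤-trans (*-monoʳ-≤ 2 (+-monoʳ-≤ k (≤-pred i≤k))) (≤-reflexive (2*[k+k]≡4*k k)))
    where
    2*[k+k]≡4*k : ∀ k → 2 * (k + k) ≡ 4 * k
    2*[k+k]≡4*k = solve-∀

  module Bounds (b : ℕ → ℕ) (N : ℕ) where
    open Spec b N

    eligible≤1 : ∀ x → eligible x ≤ 1
    eligible≤1 x = *-mono-≤ (n%2≤1 x) (sg≤1 _)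

    enumerated≤1 : ∀ e u x → enumerated e u x ≤ 1
    enumerated≤1 e u x = *-mono-≤ (eligible≤1 x) (sg≤1 _)

    enumerated-mono : ∀ e {u u′} x → u ≤ u′ → enumerated e u x ≤ enumerated e u′ x
    enumerated-mono e {u} {u′} x u≤u′ = *-monoʳ-≤ (eligible x) (sg-mono-≤ (≤-trans
      (bsum-monoʳ-≤ u (λ y _ → *-monoʳ-≤ (D⊆Y y) (sg-mono-≤ (bsum-monoˡ-≤ (λ t → sg (timed t e (x ∷ y ∷ []))) u≤u′))))
      (bsum-monoˡ-≤ (λ y → D⊆Y y * sg (bsum u′ (λ t → sg (timed t e (x ∷ y ∷ []))))) u≤u′)))

    nEnumerated-grow : ∀ e {u u′ x} → u ≤ x → x < u′ → 1 ≤ enumerated e u′ x → suc (nEnumerated e u) ≤ nEnumerated e u′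
    nEnumerated-grow e {u} {u′} {x} u≤x x<u′ x-enum = begin
      suc (nEnumerated e u)                                      ≡⟨ +-comm 1 (nEnumerated e u) ⟩
      nEnumerated e u + 1                                        ≤⟨ +-mono-≤ earlier (≤-trans x-enum′ later) ⟩
      bsum u (enumerated e u′) + bsum d (λ i → enumerated e u′ (u + i)) ≡⟨ bsum-+ u d (enumerated e u′) ⟨
      bsum (u + d) (enumerated e u′)                             ≡⟨ cong (λ n → bsum n (enumerated e u′)) (m+[n∸m]≡n u≤u′) ⟩
      nEnumerated e u′                                           ∎
      where
      open ≤-Reasoning
      u≤u′ : u ≤ u′
      u≤u′ = ≤-trans u≤x (<⇒≤ x<u′)
      d = u′ ∸ u
      earlier : nEnumerated e u ≤ bsum u (enumerated e u′)
      earlier = bsum-monoʳ-≤ u (λ y _ → enumerated-mono e y u≤u′)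
      x-enum′ : 1 ≤ enumerated e u′ (u + (x ∸ u))
      x-enum′ = subst (λ z → 1 ≤ enumerated e u′ z) (sym (m+[n∸m]≡n u≤x)) x-enum
      later : enumerated e u′ (u + (x ∸ u)) ≤ bsum d (λ i → enumerated e u′ (u + i))
      later = term≤bsum d (x ∸ u) (∸-monoˡ-< x<u′ u≤x)

    gap≤1 : ∀ k p → gap k p ≤ 1
    gap≤1 k p = *-mono-≤ (m∸n≤m 1 (suc (4 * k + p) ∸ N)) (m∸n≤m 1 (sg (bsum (suc k) (λ i → b (2 * (k + i) + p)))))

    gap-pos⁻¹ : ∀ k p → 1 ≤ gap k p → 4 * k + p < N × (∀ i → i < suc k → b (2 * (k + i) + p) ≡ 0)
    gap-pos⁻¹ k p pos with *-pos⁻¹ {χ≤ (suc (4 * k + p)) N} pos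
    ... | inside , zeros = χ≤-pos⁻¹ inside , bsum≡0⇒term≡0 (suc k) (sg≡0⇒n≡0 (1≤1∸n⇒n≡0 zeros))

    guessesRight-pos⁻¹ : ∀ e m → 1 ≤ guessesRight e m → ∃ λ u → u ≤ N × m ≤ nEnumerated e u × 1 ≤ enumerated⊆b e u
    guessesRight-pos⁻¹ e m pos with bsum-pos⁻¹ (suc N) (sg-pos⁻¹ pos)
    ... | u , u<1+N , u-pos with *-pos⁻¹ {χ≤ m (nEnumerated e u)} u-pos
    ...   | many , right = u , ≤-pred u<1+N , χ≤-pos⁻¹ many , right

    enumerated⊆b-pos⁻¹ : ∀ e u x → 1 ≤ enumerated⊆b e u → x < u → 1 ≤ enumerated e u x → 1 ≤ b x
    enumerated⊆b-pos⁻¹ e u x pos x<u enum with b x in bx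
    ... | suc _ = s≤s z≤n
    ... | zero = contradiction (subst (1 ≤_) enum≡0 enum) (λ ())
      where
      enum≡0 : enumerated e u x ≡ 0
      enum≡0 = trans (sym (*-identityʳ _)) (trans (cong (λ c → enumerated e u x * (1 ∸ c)) (sym bx))
                 (bsum≡0⇒term≡0 u (sg≡0⇒n≡0 (1≤1∸n⇒n≡0 pos)) x x<u))

  module Locality (b b′ : ℕ → ℕ) (N N′ u : ℕ) (agree : ∀ i → i < u → b i ≡ b′ i) (e : Code 2) where
    module S = Spec b N
    module S′ = Spec b′ N′

    eligible-local : ∀ x → x < u → S.eligible x ≡ S′.eligible x
    eligible-local x x<u = cong (λ c → x % 2 * sg c)
      (bsum-cong< (suc (x / 2) ∸ x / 2 / 2) (λ i i<w → agree _ (≤-<-trans (eligible-window x i i<w) x<u)))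

    inY-local : ∀ i → i < u → S.inY i ≡ S′.inY i
    inY-local i i<u = cong₂ (λ a c → a * (1 ∸ c)) (agree i i<u) (eligible-local i i<u)

    D⊆Y-local : ∀ y → y ≤ u → S.D⊆Y y ≡ S′.D⊆Y y
    D⊆Y-local y y≤u = cong (λ c → 1 ∸ sg c)
      (bsum-cong< y (λ i i<y → cong (λ c → digit y i * (1 ∸ c)) (inY-local i (<-≤-trans i<y y≤u))))

    enumerated-local : ∀ w x → w ≤ u → x < u → S.enumerated e w x ≡ S′.enumerated e w x
    enumerated-local w x w≤u x<u = cong₂ (λ a c → a * sg c) (eligible-local x x<u)
      (bsum-cong< w (λ y y<w → cong (λ c → c * sg (bsum w (λ t → sg (timed t e (x ∷ y ∷ [])))))
                                    (D⊆Y-local y (<⇒≤ (<-≤-trans y<w w≤u)))))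

    nEnumerated-local : ∀ w → w ≤ u → S.nEnumerated e w ≡ S′.nEnumerated e w
    nEnumerated-local w w≤u = bsum-cong< w (λ x x<w → enumerated-local w x w≤u (<-≤-trans x<w w≤u))

    enumerated⊆b-local : ∀ w → w ≤ u → S.enumerated⊆b e w ≡ S′.enumerated⊆b e w
    enumerated⊆b-local w w≤u = cong (λ c → 1 ∸ sg c) (bsum-cong< w (λ x x<w →
      cong₂ (λ a c → a * (1 ∸ c)) (enumerated-local w x w≤u (<-≤-trans x<w w≤u)) (agree x (<-≤-trans x<w w≤u))))

  -- Eligibility only reads even positions, so changing b at an eligible (odd)
  -- position x changes neither eligibility nor Y.
  module FlipInvariance (b b′ : ℕ → ℕ) (N N′ x : ℕ) (agree : ∀ i → i ≢ x → b i ≡ b′ i)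
                        (x-eligible : 1 ≤ Spec.eligible b N x) (e : Code 2) where
    module S = Spec b N
    module S′ = Spec b′ N′

    private
      x-odd : x % 2 ≡ 1
      x-odd with n≤1⇒n≡0∨n≡1 (n%2≤1 x)
      ... | inj₂ odd = odd
      ... | inj₁ even with () ← subst (1 ≤_) even (proj₁ (*-pos⁻¹ {x % 2} x-eligible))

      even≢x : ∀ z → 2 * z ≢ x
      even≢x z 2z≡x with () ← trans (sym (2*n%2≡0 z)) (trans (cong (_% 2) 2z≡x) x-odd)

    eligible-flip : ∀ y → S.eligible y ≡ S′.eligible y
    eligible-flip y = cong (λ c → y % 2 * sg c)
      (bsum-cong (suc (y / 2) ∸ y / 2 / 2) (λ i → agree _ (even≢x (y / 2 / 2 + i))))

    inY-flip : ∀ i → S.inY i ≡ S′.inY i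
    inY-flip i with i ≟ x
    ... | no i≢x = cong₂ (λ a c → a * (1 ∸ c)) (agree i i≢x) (eligible-flip i)
    ... | yes refl = begin
      b i * (1 ∸ S.eligible i)   ≡⟨ cong (λ c → b i * c) (1≤n⇒1∸n≡0 x-eligible) ⟩
      b i * 0                    ≡⟨ *-zeroʳ (b i) ⟩
      0                          ≡⟨ *-zeroʳ (b′ i) ⟨
      b′ i * 0                   ≡⟨ cong (λ c → b′ i * c) (1≤n⇒1∸n≡0 (subst (1 ≤_) (eligible-flip i) x-eligible)) ⟨
      b′ i * (1 ∸ S′.eligible i) ∎
      where open ≡-Reasoning

    D⊆Y-flip : ∀ y → S.D⊆Y y ≡ S′.D⊆Y y
    D⊆Y-flip y = cong (λ c → 1 ∸ sg c) (bsum-cong y (λ i → cong (λ c → digit y i * (1 ∸ c)) (inY-flip i)))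

    enumerated-flip : ∀ w z → S.enumerated e w z ≡ S′.enumerated e w z
    enumerated-flip w z = cong₂ (λ a c → a * sg c) (eligible-flip z)
      (bsum-cong w (λ y → cong (λ c → c * sg (bsum w (λ t → sg (timed t e (z ∷ y ∷ []))))) (D⊆Y-flip y)))

    nEnumerated-flip : ∀ w → S.nEnumerated e w ≡ S′.nEnumerated e w
    nEnumerated-flip w = bsum-cong w (enumerated-flip w)

  module Extension (b b′ : ℕ → ℕ) (N N′ : ℕ) (N≤N′ : N ≤ N′) (agree : ∀ i → i < N → b i ≡ b′ i) (e : Code 2) where
    module S = Spec b N
    module S′ = Spec b′ N′
    open Locality b b′ N N′ N agree e using (nEnumerated-local; enumerated⊆b-local)

    guessesRight-ext : ∀ m → 1 ≤ S.guessesRight e m → 1 ≤ S′.guessesRight e m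
    guessesRight-ext m pos with bsum-pos⁻¹ (suc N) (sg-pos⁻¹ pos)
    ... | u , u<1+N , u-pos = sg-pos (≤-trans
      (subst (1 ≤_) (cong₂ (λ a c → χ≤ m a * c) (nEnumerated-local u (≤-pred u<1+N)) (enumerated⊆b-local u (≤-pred u<1+N))) u-pos)
      (term≤bsum (suc N′) u (≤-trans u<1+N (s≤s N≤N′))))

    gap-ext : ∀ k p → S.gap k p ≤ S′.gap k p
    gap-ext k p with n≤1⇒n≡0∨n≡1 (Bounds.gap≤1 b N k p)
    ... | inj₁ gap≡0 = ≤-trans (≤-reflexive gap≡0) z≤n
    ... | inj₂ gap≡1 with Bounds.gap-pos⁻¹ b N k p (≤-reflexive (sym gap≡1))
    ...   | inside , zeros = ≤-trans (≤-reflexive gap≡1) (*-pos (χ≤-pos (≤-trans inside N≤N′)) (≤-reflexive (sym no-ones)))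
      where
      no-ones : 1 ∸ sg (bsum (suc k) (λ i → b′ (2 * (k + i) + p))) ≡ 1
      no-ones = cong (λ c → 1 ∸ sg c) (terms≡0⇒bsum≡0 (suc k)
        (λ i i≤k → trans (sym (agree _ (≤-<-trans (gap-window k i p i≤k) inside))) (zeros i i≤k)))

    gapFrom-ext : ∀ K → 1 ≤ S.gapFrom K → 1 ≤ S′.gapFrom K
    gapFrom-ext K pos with bsum-pos⁻¹ (suc N) (sg-pos⁻¹ pos)
    ... | k , k<1+N , k-pos = sg-pos (≤-trans k-pos (≤-trans
      (*-monoʳ-≤ (χ≤ K k) (+-mono-≤ (gap-ext k 0) (gap-ext k 1)))
      (term≤bsum (suc N′) k (≤-trans k<1+N (s≤s N≤N′)))))

    inG-ext : ∀ m → 1 ≤ S.inG e m → 1 ≤ S′.inG e m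
    inG-ext m pos with +-pos⁻¹ {S.guessesRight e (suc m)} (sg-pos⁻¹ pos)
    ... | inj₁ right = sg-pos (≤-trans (guessesRight-ext (suc m) right) (m≤m+n _ _))
    ... | inj₂ gaps = sg-pos (≤-trans (gapFrom-ext (m + 3) gaps) (m≤n+m _ _))

module TestMeasure where

  open import Data.Nat
  open import Data.Nat.Properties
  open import Data.Nat.DivMod
  open import Data.Bool using (Bool; true; false; _∧_; T)
  open import Data.List using (length)
  open import Data.Product using (_×_; _,_; proj₁; proj₂)
  open import Data.Sum using (inj₁; inj₂)
  open import Relation.Binary.PropositionalEquality
  open import Relation.Nullary using (yes; no)
  open import Data.Nat.Tactic.RingSolver using (solve-∀)
  open ZeroOne
  open Sums
  open BinaryDigits
  open Strings using (bitOf; bitAt)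
  open Cube
  open FlipCount using (nPicked; guesses-bound)
  open BoundedSearch
  open Geometric using (geometric-tail)
  open Test
  open TestProps

  private
    bitAt-flip-≢ : ∀ τ x i → i ≢ x → bitAt τ i ≡ bitAt (flip x τ) i
    bitAt-flip-≢ τ x i i≢x = cong boolToℕ (sym (bitOf-flip-≢ x τ i i≢x))

    bitOf-zero : ∀ τ x → bitAt τ x ≡ 0 → bitOf τ x ≡ false
    bitOf-zero τ x eq with bitOf τ x
    ... | false = refl

  module _ (e : Code 2) (M m : ℕ) where
    private
      module Sτ (τ : BStr) = Spec (bitAt τ) M

      reached : BStr → ℕ → Bool
      reached τ u = m ≤ᵇ Sτ.nEnumerated τ e u

      firstReach : BStr → ℕ
      firstReach τ = firstBelow (reached τ) (suc M)

      -- The picks are the elements enumerated at the first stage where m of them are.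
      picked : BStr → ℕ → Bool
      picked τ x = (suc x ≤ᵇ firstReach τ) ∧ ((firstReach τ ≤ᵇ M) ∧ (1 ≤ᵇ Sτ.enumerated τ e (firstReach τ) x))

      picked⁻¹ : ∀ τ x → picked τ x ≡ true → x < firstReach τ × firstReach τ ≤ M × 1 ≤ Sτ.enumerated τ e (firstReach τ) x
      picked⁻¹ τ x eq with ∧-true⁻¹ {suc x ≤ᵇ firstReach τ} eq
      ... | below , rest with ∧-true⁻¹ {firstReach τ ≤ᵇ M} rest
      ...   | reach≤M , enum = ≤ᵇ-true⁻¹ below , ≤ᵇ-true⁻¹ reach≤M , ≤ᵇ-true⁻¹ enum

      picked-< : ∀ τ → length τ ≡ M → ∀ x → picked τ x ≡ true → x < M
      picked-< τ _ x eq = let x<u , u≤M , _ = picked⁻¹ τ x eq in <-≤-trans x<u u≤M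

      picked-flip : ∀ τ → length τ ≡ M → ∀ x → picked τ x ≡ true → ∀ y → picked (flip x τ) y ≡ picked τ y
      picked-flip τ _ x eq y = sym (trans
        (cong (λ u → (suc y ≤ᵇ u) ∧ ((u ≤ᵇ M) ∧ (1 ≤ᵇ Sτ.enumerated τ e u y))) reach-flip)
        (cong (λ c → (suc y ≤ᵇ firstReach (flip x τ)) ∧ ((firstReach (flip x τ) ≤ᵇ M) ∧ (1 ≤ᵇ c)))
              (Inv.enumerated-flip (firstReach (flip x τ)) y)))
        where
        x-eligible : 1 ≤ Sτ.eligible τ x
        x-eligible = proj₁ (*-pos⁻¹ (proj₂ (proj₂ (picked⁻¹ τ x eq))))
        module Inv = FlipInvariance (bitAt τ) (bitAt (flip x τ)) M M x (bitAt-flip-≢ τ x) x-eligible e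
        reach-flip : firstReach τ ≡ firstReach (flip x τ)
        reach-flip = firstBelow-cong (suc M) (λ u → cong (m ≤ᵇ_) (Inv.nEnumerated-flip u))

      guessesRight⇒picks : ∀ τ → length τ ≡ M → 1 ≤ Sτ.guessesRight τ e m →
        m ≤ nPicked picked M τ × (∀ x → x < M → picked τ x ≡ true → bitOf τ x ≡ true)
      guessesRight⇒picks τ _ pos with Bounds.guessesRight-pos⁻¹ (bitAt τ) M e m pos
      ... | u , u≤M , m≤n , right = m≤picks , picks-in-τ
        where
        first = firstReach τ
        first≤u : first ≤ u
        first≤u = firstBelow-minimal (reached τ) (suc M) u (≤ᵇ-true m≤n) (s≤s u≤M)
        first≤M : first ≤ M
        first≤M = ≤-trans first≤u u≤M
        picks≡nEnumerated : Sτ.nEnumerated τ e first ≡ nPicked picked first τ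
        picks≡nEnumerated = bsum-cong< first (λ x x<first → trans
          (sym (boolToℕ[1≤ᵇn] (Bounds.enumerated≤1 (bitAt τ) M e first x)))
          (cong boolToℕ (sym (trans (cong (λ c → c ∧ ((first ≤ᵇ M) ∧ (1 ≤ᵇ Sτ.enumerated τ e first x))) (≤ᵇ-true x<first))
                                    (cong (λ c → c ∧ (1 ≤ᵇ Sτ.enumerated τ e first x)) (≤ᵇ-true first≤M))))))
        m≤picks : m ≤ nPicked picked M τ
        m≤picks = ≤-trans (≤ᵇ-true⁻¹ (firstBelow-found (reached τ) (suc M) (s≤s first≤M)))
                          (≤-trans (≤-reflexive picks≡nEnumerated) (bsum-monoˡ-≤ (λ x → boolToℕ (picked τ x)) first≤M))
        picks-in-τ : ∀ x → x < M → picked τ x ≡ true → bitOf τ x ≡ true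
        picks-in-τ x _ eq = let x<first , _ , enum = picked⁻¹ τ x eq in
          boolToℕ-pos⁻¹ (Bounds.enumerated⊆b-pos⁻¹ (bitAt τ) M e u x right (<-≤-trans x<first first≤u)
                                                   (≤-trans enum (Bounds.enumerated-mono (bitAt τ) M e x first≤u)))

    guessesRight-measure : cubeSum M (λ τ → Spec.guessesRight (bitAt τ) M e m) * 2 ^ m ≤ 2 ^ M
    guessesRight-measure = guesses-bound M m picked (λ _ → true) picked-flip picked-<
                                         (λ τ → Sτ.guessesRight τ e m) (λ τ → sg≤1 _) guessesRight⇒picks

  module _ (M : ℕ) where
    private
      module Sτ (τ : BStr) = Spec (bitAt τ) M

      inGap : ℕ → ℕ → ℕ → Bool
      inGap k p x = (x % 2 ≡ᵇ p) ∧ ((k ≤ᵇ x / 2) ∧ ((x / 2 ≤ᵇ 2 * k) ∧ (suc (4 * k + p) ≤ᵇ M)))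

      inGap⁻¹ : ∀ k p x → inGap k p x ≡ true → x % 2 ≡ p × k ≤ x / 2 × x / 2 ≤ 2 * k × 4 * k + p < M
      inGap⁻¹ k p x eq with ∧-true⁻¹ {x % 2 ≡ᵇ p} eq
      ... | parity , rest with ∧-true⁻¹ {k ≤ᵇ x / 2} rest
      ...   | k≤ , rest′ with ∧-true⁻¹ {x / 2 ≤ᵇ 2 * k} rest′
      ...     | ≤2k , inside = ≡ᵇ⇒≡ (x % 2) p (subst T (sym parity) _) , ≤ᵇ-true⁻¹ k≤ , ≤ᵇ-true⁻¹ ≤2k , ≤ᵇ-true⁻¹ inside

      inGap-intro : ∀ k p x → x % 2 ≡ p → k ≤ x / 2 → x / 2 ≤ 2 * k → 4 * k + p < M → inGap k p x ≡ true
      inGap-intro k p x parity k≤ ≤2k inside rewrite parity | ≤ᵇ-true k≤ | ≤ᵇ-true ≤2k | ≤ᵇ-true inside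
        with p ≡ᵇ p | ≡⇒≡ᵇ p p refl
      ... | true | _ = refl

      2*[2*k]≡4*k : ∀ k → 2 * (2 * k) ≡ 4 * k
      2*[2*k]≡4*k = solve-∀

      inGap-< : ∀ k p x → inGap k p x ≡ true → x < M
      inGap-< k p x eq with inGap⁻¹ k p x eq
      ... | parity , _ , ≤2k , inside = ≤-<-trans (begin
        x                   ≡⟨ n≡2*[n/2]+n%2 x ⟩
        2 * (x / 2) + x % 2 ≡⟨ cong (2 * (x / 2) +_) parity ⟩
        2 * (x / 2) + p     ≤⟨ +-monoˡ-≤ p (*-monoʳ-≤ 2 ≤2k) ⟩
        2 * (2 * k) + p     ≡⟨ cong (_+ p) (2*[2*k]≡4*k k) ⟩
        4 * k + p           ∎) inside
        where open ≤-Reasoning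

      inGap-count : ∀ k p → p ≤ 1 → 4 * k + p < M → k ≤ bsum M (λ x → boolToℕ (inGap k p x))
      inGap-count k p p≤1 inside = begin
        k                                                ≡⟨ bsum-const-1 k ⟨
        bsum k (λ _ → 1)                                 ≤⟨ bsum-monoʳ-≤ k (λ i _ → ≤-reflexive (sym (cong boolToℕ (≤ᵇ-true (m≤m+n k i))))) ⟩
        bsum k (λ i → late (k + i))                      ≤⟨ m≤n+m _ (bsum k late) ⟩
        bsum k late + bsum k (λ i → late (k + i))        ≡⟨ bsum-+ k k late ⟨
        bsum (k + k) late                                ≡⟨ cong (λ n → bsum (k + n) late) (+-identityʳ k) ⟨
        bsum (2 * k) late                                ≤⟨ bsum-monoʳ-≤ (2 * k) pair-hit ⟩
        bsum (2 * k) (λ q → f (2 * q) + f (suc (2 * q))) ≡⟨ bsum-pairs (2 * k) f ⟨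
        bsum (2 * (2 * k)) f                             ≤⟨ bsum-monoˡ-≤ f (≤-trans (≤-reflexive (2*[2*k]≡4*k k))
                                                                                   (≤-trans (m≤m+n (4 * k) p) (<⇒≤ inside))) ⟩
        bsum M f                                         ∎
        where
        open ≤-Reasoning
        f : ℕ → ℕ
        f x = boolToℕ (inGap k p x)
        late : ℕ → ℕ
        late q = boolToℕ (k ≤ᵇ q)
        pair-hit : ∀ q → q < 2 * k → late q ≤ f (2 * q) + f (suc (2 * q))
        pair-hit q q<2k with k ≤? q
        ... | no k≰q rewrite ≤ᵇ-false k≰q = z≤n
        ... | yes k≤q rewrite ≤ᵇ-true k≤q with n≤1⇒n≡0∨n≡1 p≤1
        ...   | inj₁ refl = ≤-trans (≤-reflexive (sym (cong boolToℕ
                  (inGap-intro k 0 (2 * q) (2*n%2≡0 q) (subst (k ≤_) (sym (2*n/2≡n q)) k≤q)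
                               (subst (_≤ 2 * k) (sym (2*n/2≡n q)) (<⇒≤ q<2k)) inside)))) (m≤m+n _ _)
        ...   | inj₂ refl = ≤-trans (≤-reflexive (sym (cong boolToℕ
                  (inGap-intro k 1 (suc (2 * q)) ([1+2*n]%2≡1 q) (subst (k ≤_) (sym ([1+2*n]/2≡n q)) k≤q)
                               (subst (_≤ 2 * k) (sym ([1+2*n]/2≡n q)) (<⇒≤ q<2k)) inside)))) (m≤n+m _ _)

      gap⇒picks : ∀ k p → p ≤ 1 → ∀ τ → length τ ≡ M → 1 ≤ Sτ.gap τ k p →
        k ≤ nPicked (λ _ → inGap k p) M τ × (∀ x → x < M → inGap k p x ≡ true → bitOf τ x ≡ false)
      gap⇒picks k p p≤1 τ _ pos with Bounds.gap-pos⁻¹ (bitAt τ) M k p pos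
      ... | inside , zeros = inGap-count k p p≤1 inside , picks-zero
        where
        picks-zero : ∀ x → x < M → inGap k p x ≡ true → bitOf τ x ≡ false
        picks-zero x _ eq with inGap⁻¹ k p x eq
        ... | parity , k≤ , ≤2k , _ = bitOf-zero τ x (trans (cong (bitAt τ) x≡) (zeros (x / 2 ∸ k) i≤k))
          where
          x≡ : x ≡ 2 * (k + (x / 2 ∸ k)) + p
          x≡ = trans (n≡2*[n/2]+n%2 x) (cong₂ (λ a c → 2 * a + c) (sym (m+[n∸m]≡n k≤)) parity)
          i≤k : x / 2 ∸ k < suc k
          i≤k = s≤s (≤-trans (∸-monoˡ-≤ k ≤2k) (≤-reflexive (trans (cong (_∸ k) (cong (k +_) (+-identityʳ k))) (m+n∸m≡n k k))))

    gap-measure : ∀ k p → p ≤ 1 → cubeSum M (λ τ → Spec.gap (bitAt τ) M k p) * 2 ^ k ≤ 2 ^ M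
    gap-measure k p p≤1 = guesses-bound M k (λ _ → inGap k p) (λ _ → false) (λ _ _ _ _ _ → refl) (λ _ _ → inGap-< k p)
                                        (λ τ → Sτ.gap τ k p) (λ τ → Bounds.gap≤1 (bitAt τ) M k p) (gap⇒picks k p p≤1)

    -- gap k 0 + gap k 1 has measure ≤ 2 / 2^k, and these add up to 2 / 2^(m+2) for k ≥ m + 3.
    gapFrom-measure : ∀ m → cubeSum M (λ τ → Spec.gapFrom (bitAt τ) M (m + 3)) * 2 ^ suc m ≤ 2 ^ M
    gapFrom-measure m = *-cancelˡ-≤ 2 (begin
      2 * (G * 2 ^ suc m)      ≡⟨ 2*[g*2^[1+m]]≡g*2^[m+2] G m ⟩
      G * 2 ^ (m + 2)          ≤⟨ *-monoˡ-≤ (2 ^ (m + 2)) G≤Σc ⟩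
      bsum (suc M) c * 2 ^ (m + 2) ≤⟨ geometric-tail c (2 * 2 ^ M) (m + 2) c≤ c≡0 (suc M) ⟩
      2 * 2 ^ M                ∎)
      where
      open ≤-Reasoning
      K = m + 3
      G = cubeSum M (λ τ → Sτ.gapFrom τ K)
      W : ℕ → ℕ → ℕ
      W k p = cubeSum M (λ τ → Sτ.gap τ k p)
      c : ℕ → ℕ
      c k = χ≤ K k * (W k 0 + W k 1)
      2*[g*2^[1+m]]≡g*2^[m+2] : ∀ g m → 2 * (g * 2 ^ suc m) ≡ g * 2 ^ (m + 2)
      2*[g*2^[1+m]]≡g*2^[m+2] g m = trans (solve g (2 ^ m)) (cong (λ n → g * 2 ^ n) (+-comm 2 m))
        where
        solve : ∀ g q → 2 * (g * (2 * q)) ≡ g * (2 * (2 * q))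
        solve = solve-∀
      G≤Σc : G ≤ bsum (suc M) c
      G≤Σc = ≤-trans (cubeSum-mono-≤ M (λ τ _ → sg≤id _)) (≤-reflexive (trans
        (cubeSum-bsum M (suc M) (λ τ k → χ≤ K k * (Sτ.gap τ k 0 + Sτ.gap τ k 1)))
        (bsum-cong (suc M) (λ k → trans (cubeSum-* M (χ≤ K k) (λ τ → Sτ.gap τ k 0 + Sτ.gap τ k 1))
                                        (cong (χ≤ K k *_) (cubeSum-+ M (λ τ → Sτ.gap τ k 0) (λ τ → Sτ.gap τ k 1)))))))
      c≤ : ∀ k → c k * 2 ^ k ≤ 2 * 2 ^ M
      c≤ k = begin
        χ≤ K k * (W k 0 + W k 1) * 2 ^ k ≤⟨ *-monoˡ-≤ (2 ^ k) (*-monoˡ-≤ (W k 0 + W k 1) (m∸n≤m 1 (K ∸ k))) ⟩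
        1 * (W k 0 + W k 1) * 2 ^ k     ≡⟨ cong (_* 2 ^ k) (*-identityˡ (W k 0 + W k 1)) ⟩
        (W k 0 + W k 1) * 2 ^ k         ≡⟨ *-distribʳ-+ (2 ^ k) (W k 0) (W k 1) ⟩
        W k 0 * 2 ^ k + W k 1 * 2 ^ k   ≤⟨ +-mono-≤ (gap-measure k 0 z≤n) (gap-measure k 1 (s≤s z≤n)) ⟩
        2 ^ M + 2 ^ M                   ≡⟨ cong (2 ^ M +_) (+-identityʳ (2 ^ M)) ⟨
        2 * 2 ^ M                       ∎
      c≡0 : ∀ k → k ≤ m + 2 → c k ≡ 0
      c≡0 k k≤ = cong (_* (W k 0 + W k 1)) (1≤n⇒1∸n≡0 (m<n⇒0<n∸m (≤-trans (s≤s k≤) (≤-reflexive (sym (+-suc m 2))))))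

  inG-measure : ∀ e M m → cubeSum M (λ τ → Spec.inG (bitAt τ) M e m) * 2 ^ m ≤ 2 ^ M
  inG-measure e M m = *-cancelʳ-≤ _ (2 ^ M) 2 (begin
    cubeSum M inG * 2 ^ m * 2                             ≡⟨ *-assoc (cubeSum M inG) (2 ^ m) 2 ⟩
    cubeSum M inG * (2 ^ m * 2)                           ≡⟨ cong (cubeSum M inG *_) (*-comm (2 ^ m) 2) ⟩
    cubeSum M inG * 2 ^ suc m                             ≤⟨ *-monoˡ-≤ (2 ^ suc m) inG≤ ⟩
    (cubeSum M right + cubeSum M gaps) * 2 ^ suc m        ≡⟨ *-distribʳ-+ (2 ^ suc m) (cubeSum M right) (cubeSum M gaps) ⟩
    cubeSum M right * 2 ^ suc m + cubeSum M gaps * 2 ^ suc m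
                                                          ≤⟨ +-mono-≤ (guessesRight-measure e M (suc m)) (gapFrom-measure M m) ⟩
    2 ^ M + 2 ^ M                                         ≡⟨ cong (2 ^ M +_) (*-identityˡ (2 ^ M)) ⟨
    2 ^ M + 1 * 2 ^ M                                     ≡⟨ *-comm 2 (2 ^ M) ⟩
    2 ^ M * 2                                             ∎)
    where
    open ≤-Reasoning
    inG right gaps : BStr → ℕ
    inG τ = Spec.inG (bitAt τ) M e m
    right τ = Spec.guessesRight (bitAt τ) M e (suc m)
    gaps τ = Spec.gapFrom (bitAt τ) M (m + 3)
    inG≤ : cubeSum M inG ≤ cubeSum M right + cubeSum M gaps
    inG≤ = ≤-trans (cubeSum-mono-≤ M (λ τ _ → sg≤id _)) (≤-reflexive (cubeSum-+ M right gaps))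

module TestCode where

  open import Data.Nat
  open import Data.Nat.Properties
  open import Data.Bool using (true; false)
  open import Data.Bool.ListAction using (any)
  open import Data.List using ([]; _∷_; length; map)
  open import Data.List.Relation.Unary.All using (All; []; _∷_)
  open import Data.Fin using (zero; suc)
  open import Data.Vec using ([]; _∷_)
  open import Data.Product using (∃; _×_; _,_)
  open import Relation.Binary.PropositionalEquality
  open ZeroOne using (boolToℕ; 1≤n⇒1∸n≡0)
  open PrimRec
  open OracleExpr
  open Strings
  open Cube using (cubeSum; cubeSum-mono-≤; countCov≡cubeSum)
  open Test
  open TestProps using (module Extension)
  open TestMeasure using (inG-measure)

  isPrefix⁻¹ : ∀ σ τ → isPrefix σ τ ≡ true → length σ ≤ length τ × (∀ i → i < length σ → bitAt σ i ≡ bitAt τ i)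
  isPrefix⁻¹ [] τ _ = z≤n , λ i ()
  isPrefix⁻¹ (true ∷ σ) (true ∷ τ) eq with isPrefix⁻¹ σ τ eq
  ... | ≤len , agree = s≤s ≤len , λ { zero _ → refl ; (suc i) (s≤s i<) → agree i i< }
  isPrefix⁻¹ (false ∷ σ) (false ∷ τ) eq with isPrefix⁻¹ σ τ eq
  ... | ≤len , agree = s≤s ≤len , λ { zero _ → refl ; (suc i) (s≤s i<) → agree i i< }

  module _ (e : Code 2) where
    open Compile codeBitPR codeLengthPR

    inGPR : PR 2
    inGPR = compile (Program.inGᴱ e)

    inGPR-str : ∀ m s → fn inGPR (s ∷ m ∷ []) ≡ Spec.inG (bitAt (str s)) (length (str s)) e m
    inGPR-str m s = trans (compile-correct (Program.inGᴱ e) s (m ∷ []))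
      (trans (SemCong.⟦⟧-cong (query s) (bitAt (str s)) (bound s) (length (str s))
                              (λ i → sym (bitAt-str s i)) (sym (length-str s)) (Program.inGᴱ e) (m ∷ []))
             (Program.⟦inGᴱ⟧ e (bitAt (str s)) (length (str s)) m))

    outsideGPR : PR 3
    outsideGPR = compPR monusPR (constPR 1 ∷ compPR inGPR (projPR (suc (suc zero)) ∷ projPR (suc zero) ∷ []) ∷ [])

    -- A μ-search over a dummy variable: it halts on (m, s) iff str s lies in G_m.
    testCode : Code 2
    testCode = muC (code outsideGPR)

    testCode-halts⁻¹ : ∀ m s → Halts testCode (m ∷ s ∷ []) → 1 ≤ Spec.inG (bitAt (str s)) (length (str s)) e m
    testCode-halts⁻¹ m s (k , ev-mu zero-at-k _) =
      subst (1 ≤_) (inGPR-str m s) (1∸n≡0⇒1≤n (⇓-deterministic zero-at-k (computes outsideGPR (k ∷ m ∷ s ∷ []))))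
      where
      1∸n≡0⇒1≤n : ∀ {n} → 0 ≡ 1 ∸ n → 1 ≤ n
      1∸n≡0⇒1≤n {suc n} _ = s≤s z≤n

    testCode-halts : ∀ m s → 1 ≤ Spec.inG (bitAt (str s)) (length (str s)) e m → Halts testCode (m ∷ s ∷ [])
    testCode-halts m s pos = 0 , ev-mu (subst (code outsideGPR [ 0 ∷ m ∷ s ∷ [] ]⇓_) (1≤n⇒1∸n≡0 (subst (1 ≤_) (sym (inGPR-str m s)) pos))
                                              (computes outsideGPR (0 ∷ m ∷ s ∷ [])))
                                       (λ _ ())

    private
      covering-code : ∀ m τ L → All (λ s → Halts testCode (m ∷ s ∷ [])) L → any (λ σ → isPrefix σ τ) (map str L) ≡ true →
                      ∃ λ s → Halts testCode (m ∷ s ∷ []) × isPrefix (str s) τ ≡ true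
      covering-code m τ (s ∷ L) (halts ∷ all-halt) eq with isPrefix (str s) τ in prefix
      ... | true = s , halts , prefix
      ... | false = covering-code m τ L all-halt eq

    -- Every string extending an enumerated one lies in G_m, so at resolution
    -- maxLen the covered strings are counted by inG-measure.
    testCode-isMLTest : IsMLTest testCode
    testCode-isMLTest m L all-halt = begin
      countCov M (map str L) * 2 ^ m                      ≡⟨ cong (_* 2 ^ m) (countCov≡cubeSum M (map str L)) ⟩
      cubeSum M covered * 2 ^ m                           ≤⟨ *-monoˡ-≤ (2 ^ m) (cubeSum-mono-≤ M covered≤inG) ⟩
      cubeSum M (λ τ → Spec.inG (bitAt τ) M e m) * 2 ^ m  ≤⟨ inG-measure e M m ⟩
      2 ^ M                                               ∎
      where
      open ≤-Reasoning
      M = maxLen (map str L)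
      covered : BStr → ℕ
      covered τ = boolToℕ (any (λ σ → isPrefix σ τ) (map str L))
      covered≤inG : ∀ τ → length τ ≡ M → covered τ ≤ Spec.inG (bitAt τ) M e m
      covered≤inG τ len with any (λ σ → isPrefix σ τ) (map str L) in covered
      ... | false = z≤n
      ... | true with covering-code m τ L all-halt covered
      ...   | s , halts , prefix with isPrefix⁻¹ (str s) τ prefix
      ...     | ≤len , agree = subst (λ N → 1 ≤ Spec.inG (bitAt τ) N e m) len
                  (Extension.inG-ext (bitAt (str s)) (bitAt τ) (length (str s)) (length τ) ≤len agree e m
                                     (testCode-halts⁻¹ m s halts))

module Covering where

  open import Data.Nat
  open import Data.Nat.Properties
  open import Data.Nat.DivMod
  open import Data.Bool using (true)
  open import Data.List using (length)
  open import Data.Product using (∃; ∃₂; _×_; _,_; proj₁; proj₂)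
  open import Data.Sum using (_⊎_; inj₁; inj₂)
  open import Data.Vec using ([]; _∷_)
  open import Function.Bundles using (Equivalence)
  open import Relation.Binary.PropositionalEquality
  open import Data.Nat.Tactic.RingSolver using (solve-∀)
  open ZeroOne
  open Sums
  open BinaryDigits
  open Strings using (bitAt; restrict; length-restrict; bitOf-restrict; restrict≺)
  open Timed using (timed; timed-sound; timed-complete)
  open Test
  open TestProps

  module _ (A : Set2ω) where

    a : ℕ → ℕ
    a i = boolToℕ (A i)

    open Spec a 0 using (eligible; inY)

    Y : Set2ω
    Y i = 1 ≤ᵇ inY i

    Y⊆A : Y ⊆ A
    Y⊆A i i∈Y = boolToℕ-pos⁻¹ (proj₁ (*-pos⁻¹ {a i} (≤ᵇ-true⁻¹ {1} {inY i} i∈Y)))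

    Y-intro : ∀ z → A z ≡ true → eligible z ≡ 0 → Y z ≡ true
    Y-intro z z∈A z-ineligible rewrite z∈A | z-ineligible = refl

    even-ineligible : ∀ j → eligible (2 * j) ≡ 0
    even-ineligible j = cong (_* sg (bsum (suc (2 * j / 2) ∸ 2 * j / 2 / 2) (λ i → a (2 * (2 * j / 2 / 2 + i)))))
                             (2*n%2≡0 j)

    Y-infinite : Infinite A → Infinite Y
    Y-infinite A-inf n with A-inf (2 * suc n)
    ... | x , x≥ , x∈A with eligible x in x-eligible
    ...   | zero = x , ≤-trans (m≤n*m n 2) (≤-trans (*-monoʳ-≤ 2 (n≤1+n n)) x≥) , Y-intro x x∈A x-eligible
    ...   | suc _ with bsum-pos⁻¹ (suc (x / 2) ∸ x / 2 / 2) (sg-pos⁻¹ (proj₂ (*-pos⁻¹ {x % 2} (≤-trans (s≤s z≤n) (≤-reflexive (sym x-eligible))))))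
    ...     | i , i<w , z∈A = z , n≤z , Y-intro z (boolToℕ-pos⁻¹ z∈A) (even-ineligible (x / 2 / 2 + i))
      where
      h = x / 2
      z = 2 * (h / 2 + i)
      n<h : suc n ≤ h
      n<h = subst (_≤ h) (2*n/2≡n (suc n)) (/-monoˡ-≤ 2 x≥)
      n≤z : n ≤ z
      n≤z = ≤-trans (≤-pred (≤-trans n<h (≤-trans (≤-reflexive (n≡2*[n/2]+n%2 h))
                      (≤-trans (+-monoʳ-≤ (2 * (h / 2)) (n%2≤1 h)) (≤-reflexive (+-comm _ 1))))))
                    (*-monoʳ-≤ 2 (m≤m+n (h / 2) i))

    Gap : ℕ → ℕ → Set
    Gap k p = ∀ i → i < suc k → a (2 * (k + i) + p) ≡ 0

    private
      window : ∀ q j → q / 2 + j ≤ q → j < suc q ∸ q / 2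
      window q j le = m+n≤o⇒m≤o∸n (suc j) (s≤s (≤-trans (≤-reflexive (+-comm j (q / 2))) le))

      eligible-odd : ∀ q j → q / 2 + j ≤ q → 1 ≤ a (2 * (q / 2 + j)) → 1 ≤ eligible (suc (2 * q))
      eligible-odd q j le even∈A rewrite [1+2*n]%2≡1 q | [1+2*n]/2≡n q =
        ≤-trans (sg-pos (≤-trans even∈A (term≤bsum (suc q ∸ q / 2) j (window q j le)))) (≤-reflexive (sym (+-identityʳ _)))

    odd-eligible-or-gap : ∀ h → 1 ≤ eligible (suc (2 * h)) ⊎ Gap (h / 2) 0
    odd-eligible-or-gap h with bsum (suc h ∸ h / 2) (λ i → a (2 * (h / 2 + i))) in evens
    ... | suc _ with bsum-pos⁻¹ (suc h ∸ h / 2) (≤-trans (s≤s z≤n) (≤-reflexive (sym evens)))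
    ...   | j , j<w , even∈A = inj₁ (eligible-odd h j (subst (_≤ h) (+-comm j (h / 2))
                                     (≤-pred (m≤o∸n⇒m+n≤o (suc j) (≤-trans (m/n≤m h 2) (n≤1+n h)) j<w))) even∈A)
    odd-eligible-or-gap h | zero = inj₂ λ i i≤k → trans (cong a (+-identityʳ _))
                                      (bsum≡0⇒term≡0 (suc h ∸ h / 2) evens i (window h i (k+i≤h i≤k)))
      where
      k+i≤h : ∀ {i} → i < suc (h / 2) → h / 2 + i ≤ h
      k+i≤h i≤k = ≤-trans (+-monoʳ-≤ (h / 2) (≤-pred i≤k)) (≤-trans (≤-reflexive (cong (h / 2 +_) (sym (+-identityʳ (h / 2)))))
                    (≤-trans (m≤m+n (2 * (h / 2)) (h % 2)) (≤-reflexive (sym (n≡2*[n/2]+n%2 h)))))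

    -- An even element 2k of A makes every odd number in (2k, 4k + 1] eligible.
    even-eligible-or-gap : ∀ k → A (2 * k) ≡ true →
      (∃ λ i → i ≤ k × A (2 * (k + i) + 1) ≡ true × 1 ≤ eligible (2 * (k + i) + 1)) ⊎ Gap k 1
    even-eligible-or-gap k 2k∈A with bsum (suc k) (λ i → a (2 * (k + i) + 1)) in odds
    ... | zero = inj₂ (bsum≡0⇒term≡0 (suc k) odds)
    ... | suc _ with bsum-pos⁻¹ (suc k) (≤-trans (s≤s z≤n) (≤-reflexive (sym odds)))
    ...   | i , i≤k , odd∈A = inj₁ (i , ≤-pred i≤k , boolToℕ-pos⁻¹ odd∈A ,
                                     subst (λ z → 1 ≤ eligible z) (+-comm 1 (2 * q)) eligible-2q+1)
      where
      q = k + i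
      q/2≤k : q / 2 ≤ k
      q/2≤k = ≤-trans (/-monoˡ-≤ 2 (≤-trans (+-monoʳ-≤ k (≤-pred i≤k)) (≤-reflexive (cong (k +_) (sym (+-identityʳ k))))))
                      (≤-reflexive (2*n/2≡n k))
      q/2+[k∸q/2]≡k : q / 2 + (k ∸ q / 2) ≡ k
      q/2+[k∸q/2]≡k = m+[n∸m]≡n q/2≤k
      eligible-2q+1 : 1 ≤ eligible (suc (2 * q))
      eligible-2q+1 = eligible-odd q (k ∸ q / 2) (≤-trans (≤-reflexive q/2+[k∸q/2]≡k) (m≤m+n k i))
                        (≤-reflexive (sym (trans (cong (λ w → a (2 * w)) q/2+[k∸q/2]≡k) (cong boolToℕ 2k∈A))))

    EligibleFrom GapFrom : ℕ → Set
    EligibleFrom n = ∃ λ x → n ≤ x × A x ≡ true × 1 ≤ eligible x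
    GapFrom n = ∃₂ λ k p → n ≤ 4 * k + 3 × p ≤ 1 × Gap k p

    eligible-or-gap : Infinite A → ∀ n → EligibleFrom n ⊎ GapFrom n
    eligible-or-gap A-inf n with A-inf n
    ... | x , n≤x , x∈A with n≤1⇒n≡0∨n≡1 (n%2≤1 x)
    ...   | inj₂ odd = odd-case (trans (n≡2*[n/2]+n%2 x) (trans (cong (2 * (x / 2) +_) odd) (+-comm _ 1)))
      where
      h = x / 2
      odd-case : x ≡ suc (2 * h) → EligibleFrom n ⊎ GapFrom n
      odd-case x≡ with odd-eligible-or-gap h
      ... | inj₁ x-eligible = inj₁ (x , n≤x , x∈A , subst (λ z → 1 ≤ eligible z) (sym x≡) x-eligible)
      ... | inj₂ gap = inj₂ (h / 2 , 0 , ≤-trans n≤x (≤-trans (≤-reflexive x≡) (≤-trans (s≤s (*-monoʳ-≤ 2 h≤)) (≤-reflexive (expand (h / 2))))) , z≤n , gap)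
        where
        h≤ : h ≤ 2 * (h / 2) + 1
        h≤ = ≤-trans (≤-reflexive (n≡2*[n/2]+n%2 h)) (+-monoʳ-≤ (2 * (h / 2)) (n%2≤1 h))
        expand : ∀ k → suc (2 * (2 * k + 1)) ≡ 4 * k + 3
        expand = solve-∀
    ...   | inj₁ even = even-case (trans (n≡2*[n/2]+n%2 x) (trans (cong (2 * (x / 2) +_) even) (+-identityʳ _)))
      where
      k = x / 2
      even-case : x ≡ 2 * k → EligibleFrom n ⊎ GapFrom n
      even-case x≡ with even-eligible-or-gap k (subst (λ z → A z ≡ true) x≡ x∈A)
      ... | inj₁ (i , _ , odd∈A , odd-eligible) =
        inj₁ (2 * (k + i) + 1 , ≤-trans n≤x (≤-trans (≤-reflexive x≡) (≤-trans (*-monoʳ-≤ 2 (m≤m+n k i)) (m≤m+n _ 1))) , odd∈A , odd-eligible)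
      ... | inj₂ gap = inj₂ (k , 1 , ≤-trans n≤x (≤-trans (≤-reflexive x≡) (≤-trans (*-monoˡ-≤ k (s≤s (s≤s (z≤n {2})))) (m≤m+n (4 * k) 3))) ,
                             s≤s z≤n , gap)

    gap-prefix : ∀ K k p → K ≤ k → p ≤ 1 → Gap k p →
                 1 ≤ Spec.gapFrom (bitAt (restrict A (suc (4 * k + p)))) (suc (4 * k + p)) K
    gap-prefix K k p K≤k p≤1 gap = sg-pos (≤-trans (*-pos (χ≤-pos K≤k) gaps)
                                                                  (term≤bsum (suc N) k (s≤s (≤-trans (m≤m*n k 4) k*4≤N))))
      where
      N = suc (4 * k + p)
      module Sτ = Spec (bitAt (restrict A N)) N
      k*4≤N : k * 4 ≤ N
      k*4≤N = ≤-trans (≤-reflexive (*-comm k 4)) (≤-trans (m≤m+n (4 * k) p) (n≤1+n _))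
      gap-p : 1 ≤ Sτ.gap k p
      gap-p = *-pos (χ≤-pos {N} ≤-refl) (≤-reflexive (sym (cong (λ c → 1 ∸ sg c) (terms≡0⇒bsum≡0 (suc k)
                (λ i i≤k → trans (cong boolToℕ (bitOf-restrict A N (2 * (k + i) + p) (s≤s (gap-window k i p i≤k)))) (gap i i≤k))))))
      gaps : 1 ≤ Sτ.gap k 0 + Sτ.gap k 1
      gaps with n≤1⇒n≡0∨n≡1 p≤1
      ... | inj₁ refl = ≤-trans gap-p (m≤m+n _ _)
      ... | inj₂ refl = ≤-trans gap-p (m≤n+m _ _)

    module _ (A-inf : Infinite A) (e : Code 2) (Γ : e applied Y ≡ A) where

      open Spec a 0 using (D⊆Y; enumerated; nEnumerated; enumerated⊆b)

      D⊆Y≡1 : ∀ y → D[ y ]⊆ Y → D⊆Y y ≡ 1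
      D⊆Y≡1 y Dy⊆Y = cong (λ c → 1 ∸ sg c) (terms≡0⇒bsum≡0 y outside-Y)
        where
        outside-Y : ∀ i → i < y → digit y i * (1 ∸ inY i) ≡ 0
        outside-Y i _ with n≤1⇒n≡0∨n≡1 (digit≤1 y i)
        ... | inj₁ digit≡0 = cong (_* (1 ∸ inY i)) digit≡0
        ... | inj₂ digit≡1 = trans (cong (digit y i *_) (1≤n⇒1∸n≡0 (≤ᵇ-true⁻¹ {1} {inY i} (Dy⊆Y i (trans (bit≡digit y i) digit≡1)))))
                                   (*-zeroʳ (digit y i))

      D⊆Y-pos⁻¹ : ∀ y → 1 ≤ D⊆Y y → D[ y ]⊆ Y
      D⊆Y-pos⁻¹ y pos i bit≡1 = ≤ᵇ-true {1} {inY i} (m∸n≡0⇒m≤n (trans (sym (*-identityˡ (1 ∸ inY i)))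
        (trans (cong (_* (1 ∸ inY i)) (sym (trans (sym (bit≡digit y i)) bit≡1)))
               (bsum≡0⇒term≡0 y (sg≡0⇒n≡0 (1≤1∸n⇒n≡0 pos)) i (bit≡1⇒<y y i bit≡1)))))

      enumerated⇒A : ∀ u x → 1 ≤ enumerated e u x → A x ≡ true
      enumerated⇒A u x pos with bsum-pos⁻¹ u (sg-pos⁻¹ (proj₂ (*-pos⁻¹ {eligible x} pos)))
      ... | y , _ , y-pos with *-pos⁻¹ {D⊆Y y} y-pos
      ...   | Dy⊆Y , halts with bsum-pos⁻¹ u (sg-pos⁻¹ halts)
      ...     | t , _ , halts-by-t with timed t e (x ∷ y ∷ []) in timed≡
      ...       | suc r = Equivalence.to (Γ x) (y , (r , timed-sound t e (x ∷ y ∷ []) r timed≡) , D⊆Y-pos⁻¹ y Dy⊆Y)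

      A⇒enumerated : ∀ x → A x ≡ true → 1 ≤ eligible x → Timed.Eventually (λ u → 1 ≤ enumerated e u x)
      A⇒enumerated x x∈A x-eligible with Equivalence.from (Γ x) x∈A
      ... | y , (r , e⇓) , Dy⊆Y with timed-complete e⇓
      ...   | T , by-T = suc (y ⊔ T) , λ u u> → *-pos x-eligible (sg-pos (≤-trans (witness u u>)
                                              (term≤bsum u y (≤-trans (s≤s (m≤m⊔n y T)) u>))))
        where
        witness : ∀ u → suc (y ⊔ T) ≤ u → 1 ≤ D⊆Y y * sg (bsum u (λ t → sg (timed t e (x ∷ y ∷ []))))
        witness u u> = *-pos (≤-reflexive (sym (D⊆Y≡1 y Dy⊆Y)))
          (sg-pos (≤-trans (≤-reflexive (sym (cong sg (by-T T ≤-refl)))) (term≤bsum u T (≤-trans (s≤s (m≤n⊔m y T)) u>))))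

      enumerated⊆A : ∀ u → 1 ≤ enumerated⊆b e u
      enumerated⊆A u = ≤-reflexive (sym (cong (λ c → 1 ∸ sg c) (terms≡0⇒bsum≡0 u in-A)))
        where
        in-A : ∀ x → x < u → enumerated e u x * (1 ∸ a x) ≡ 0
        in-A x _ with n≤1⇒n≡0∨n≡1 (Bounds.enumerated≤1 a 0 e u x)
        ... | inj₁ enum≡0 = cong (_* (1 ∸ a x)) enum≡0
        ... | inj₂ enum≡1 = trans (cong (λ c → enumerated e u x * (1 ∸ boolToℕ c)) (enumerated⇒A u x (≤-reflexive (sym enum≡1))))
                                  (*-zeroʳ (enumerated e u x))

      many-enumerated-or-gap : ∀ K c → (∃ λ u → c ≤ nEnumerated e u) ⊎ (∃₂ λ k p → K ≤ k × p ≤ 1 × Gap k p)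
      many-enumerated-or-gap K zero = inj₁ (0 , z≤n)
      many-enumerated-or-gap K (suc c) with many-enumerated-or-gap K c
      ... | inj₂ gap = inj₂ gap
      ... | inj₁ (u , c≤) with eligible-or-gap A-inf (u ⊔ (4 * K + 3))
      ...   | inj₂ (k , p , ≤4k+3 , p≤1 , gap) =
        inj₂ (k , p , *-cancelˡ-≤ 4 (+-cancelʳ-≤ 3 (4 * K) (4 * k) (≤-trans (m≤n⊔m u (4 * K + 3)) ≤4k+3)) , p≤1 , gap)
      ...   | inj₁ (x , x≥ , x∈A , x-eligible) with A⇒enumerated x x∈A x-eligible
      ...     | U , enumerated-from-U = inj₁ (u′ , ≤-trans (s≤s c≤)
                  (Bounds.nEnumerated-grow a 0 e (≤-trans (m≤m⊔n u (4 * K + 3)) x≥) x<u′ (enumerated-from-U u′ U≤u′)))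
        where
        u′ = U ⊔ suc x
        x<u′ : x < u′
        x<u′ = m≤n⊔m U (suc x)
        U≤u′ : U ≤ u′
        U≤u′ = m≤m⊔n U (suc x)

      A-covered : ∀ m → ∃ λ τ → τ ≺ A × 1 ≤ Spec.inG (bitAt τ) (length τ) e m
      A-covered m with many-enumerated-or-gap (m + 3) (suc m)
      ... | inj₁ (u , many) = restrict A u , restrict≺ A u ,
              subst (λ N → 1 ≤ Spec.inG (bitAt (restrict A u)) N e m) (sym (length-restrict A u))
                    (sg-pos (≤-trans guesses-right (m≤m+n _ _)))
        where
        agree : ∀ i → i < u → a i ≡ bitAt (restrict A u) i
        agree i i<u = sym (cong boolToℕ (bitOf-restrict A u i i<u))
        module L = Locality a (bitAt (restrict A u)) 0 u u agree e
        guesses-right : 1 ≤ Spec.guessesRight (bitAt (restrict A u)) u e (suc m)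
        guesses-right = sg-pos (≤-trans (*-pos (χ≤-pos (subst (suc m ≤_) (L.nEnumerated-local u ≤-refl) many))
                                               (subst (1 ≤_) (L.enumerated⊆b-local u ≤-refl) (enumerated⊆A u)))
                                        (term≤bsum (suc u) u ≤-refl))
      ... | inj₂ (k , p , K≤k , p≤1 , gap) = restrict A N , restrict≺ A N ,
              subst (λ N′ → 1 ≤ Spec.inG (bitAt (restrict A N)) N′ e m) (sym (length-restrict A N))
                    (sg-pos (≤-trans (gap-prefix (m + 3) k p K≤k p≤1 gap) (m≤n+m _ _)))
        where
        N = suc (4 * k + p)

open import Data.Nat using (_≤_)
open import Data.List using (length)
open import Data.Product using (_,_)
open import Relation.Binary.PropositionalEquality using (subst; sym)
open Strings using (bitAt; encode; str-encode)
open Test using (module Spec)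
open TestCode using (testCode; testCode-isMLTest; testCode-halts)
open Covering using (Y; Y-infinite; Y⊆A; A-covered)

mainTheorem12 : ∀ (A : Set2ω) → MLRandom A → ¬ Introenumerable A
mainTheorem12 A A-random (A-infinite , introenumerable) with introenumerable (Y A) (Y-infinite A A-infinite) (Y⊆A A)
... | e , Γ = A-random (testCode e) (testCode-isMLTest e) A∈G
  where
  A∈G : ∀ m → A ∈G[ testCode e ] m
  A∈G m with A-covered A A-infinite e Γ m
  ... | τ , τ≺A , τ∈G = encode τ ,
                        testCode-halts e m (encode τ) (subst (λ σ → 1 ≤ Spec.inG (bitAt σ) (length σ) e m) (sym (str-encode τ)) τ∈G) ,
                        subst (_≺ A) (sym (str-encode τ)) τ≺A
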